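{- Let $k\ge 3$, $R=\{1,2\}$, $S=\{3,4,\ldots,k\}$, and let $I$ be a finite subset of $\mathbb{Z}^+\setminus(R\cup S)$. Then \[\lim_{n\to\infty}\frac{p_{R>S,I}(n)}{p_{RSI}(n)}=\frac{6k}{(k+1)(k+2)}.\]
   Context: For pairwise disjoint sets $R,S,I\subseteq\mathbb{Z}^+$, $p_{RSI}(n)$ denotes the number of partitions of $n$ all of whose parts lie in $R\cup S\cup I$, and $p_{R>S,I}(n)$ denotes the number of those partitions in which the number of parts lying in $R$ (counted with multiplicity) is strictly greater than the number of parts lying in $S$ (counted with multiplicity). -}

module Defs where

open import Data.Nat using (ℕ; zero; suc; _+_; _*_; _∸_; _≤?_; _<?_)
open import Data.List using (List; []; _∷_; [_]; _++_; map; concatMap; filter; upTo; length; take; drop)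
open import Data.Nat.ListAction using (sum)
open import Data.Integer using (+_)
open import Data.Rational using (ℚ; _/_; 0ℚ; _-_; ∣_∣; _<_)
open import Data.Product using (∃-syntax)
open import Data.Nat as ℕ using ()

-- multVecs ds n : all multiplicity vectors (m₁,…,m_r) (one entry per element
-- of the list ds of distinct positive part sizes) with Σ mᵢ·dᵢ = n.
-- These are in bijection with partitions of n whose parts lie in ds.
multVecs : List ℕ → ℕ → List (List ℕ)
multVecs []       zero    = [ [] ]
multVecs []       (suc _) = []
multVecs (d ∷ ds) n =
  concatMap (λ j → map (j ∷_) (multVecs ds (n ∸ j * d)))
            (filter (λ j → j * d ≤? n) (upTo (suc n)))

-- p_{RSI}(n): number of partitions of n with all parts in R ∪ S ∪ I
-- (R, S, I given as duplicate-free lists of positive integers, pairwise disjoint).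
pRSI : List ℕ → List ℕ → List ℕ → ℕ → ℕ
pRSI R S I n = length (multVecs (R ++ S ++ I) n)

partsR : List ℕ → List ℕ → ℕ
partsR R m = sum (take (length R) m)

partsS : List ℕ → List ℕ → List ℕ → ℕ
partsS R S m = sum (take (length S) (drop (length R) m))

pR>S : List ℕ → List ℕ → List ℕ → ℕ → ℕ
pR>S R S I n =
  length (filter (λ m → partsS R S m <? partsR R m) (multVecs (R ++ S ++ I) n))

-- a / b as a rational number (b = 0 sent to 0; never used with b = 0 here)
ratio : ℕ → ℕ → ℚ
ratio a zero    = 0ℚ
ratio a (suc b) = (+ a) / suc b

ConvergesTo : (ℕ → ℚ) → ℚ → Set
ConvergesTo f L = ∀ (ε : ℚ) → 0ℚ < ε → ∃[ N ] (∀ n → N ℕ.≤ n → ∣ f n - L ∣ < ε)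

rangeS : ℕ → List ℕ
rangeS k = map (λ i → i + 3) (upTo (k ∸ 2))

{-# OPTIONS --safe #-}
-- A partition counted by p_{RSI}(n) is a pair of multiplicities j₁, j₂ of the parts 1 and 2 together with
-- a partition of the remaining size w into parts from S ∪ I, s of them in S.  For fixed w and s and r = n ∸ w,
-- the pairs with j₁ + 2j₂ = r and j₁ + j₂ > s number (r ∸ s) − ⌊(r ∸ (2s + 1))/2⌋, where r ∸ s counts the
-- pairs with j₁ + j₂ = r − 1 − s and ⌊(r ∸ (2s + 1))/2⌋ those with j₁ + 2j₂ = r − 3 − 2s.  Adding 1, resp. 2,
-- to every part size in S adds s, resp. 2s, to the size, so summing over the rest of the partition gives
--   p_{R>S,I}(n) + p(n − 3; 1, 2, S + 2, I) = p(n − 1; 1, 1, S + 1, I)       (n ≥ 3),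
-- where p(m; L) counts partitions of m with parts from the list L, repeated entries being distinct colours.
-- Partitions of m with parts from 1, L are partitions of size at most m with parts from L, and there are
-- m^|L| / (|L|! ∏ L) + O(m^(|L| − 1)) of them: adjoining a part size a turns the count into a sum over the
-- multiples of a, a Riemann sum.  The three counts have the same degree as p_{RSI}(n) = p(n; 1, 2, S, I), so
-- the ratio tends to D₀/D₁ − D₀/D₂ with D = |L|! ∏ L, and for S = {3, …, k} the products telescope to
-- D₀/D₁ = 6(k + 2)/((k + 1)(k + 2)) and D₀/D₂ = 12/((k + 1)(k + 2)).

module Submission where

open import Defs
open import Data.Nat using (ℕ; _≤_; _<_; _*_; _+_)
open import Data.List using (List; _∷_; [])
open import Data.List.Relation.Unary.All using (All)
open import Data.List.Relation.Unary.Unique.Propositional using (Unique)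

import Algebra.Properties.CommutativeSemigroup as CommSemigroupProperties
open import Data.Bool using (if_then_else_)
open import Data.Integer as ℤ using (-[1+_]; _⊖_)
import Data.Integer.Properties as ℤ
open import Data.List using (_++_; [_]; map; concatMap; filter; upTo; applyUpTo; length)
open import Data.List.Properties using (length-++; length-map; map-++; map-∘; map-cong; map-upTo; upTo-∷ʳ)
open import Data.List.Relation.Unary.All as All using ([]; _∷_; universal)
import Data.List.Relation.Unary.All.Properties as AllP
open import Data.Nat
open import Data.Nat.Induction using (<-rec)
open import Data.Nat.ListAction using (sum; product)
open import Data.Nat.ListAction.Properties using (sum-++; product-++)
open import Data.Nat.Properties
open import Data.Nat.Tactic.RingSolver using (solve-∀)
open import Data.Product using (_×_; _,_; ∃-syntax)
open import Data.Rational as ℚ using (ℚ; mkℚ; 0ℚ; toℚᵘ)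
import Data.Rational.Properties as ℚ
open import Data.Rational.Unnormalised as ℚᵘ using (mkℚᵘ; *<*)
import Data.Rational.Unnormalised.Properties as ℚᵘ
open import Data.Sum using (inj₁; inj₂)
open import Function using (_∘_; _⇔_; mk⇔; Equivalence)
open import Function.Properties.Equivalence using (⇔-setoid)
open import Level using (0ℓ)
open import Relation.Binary.PropositionalEquality using (_≡_; _≢_; refl; sym; trans; cong; cong₂; subst; subst₂; module ≡-Reasoning)
import Relation.Binary.Reasoning.Setoid as SetoidReasoning
open import Relation.Nullary using (Dec; does; yes; no; ¬_; _×-dec_; contradiction)

module +-CS = CommSemigroupProperties +-commutativeSemigroup
module *-CS = CommSemigroupProperties *-commutativeSemigroup
module ⇔-Reasoning = SetoidReasoning (⇔-setoid 0ℓ)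

-- Arithmetic on ℕ

m≤o∸n⇔m+n≤o : ∀ m {n o} → n ≤ o → (m ≤ o ∸ n) ⇔ (m + n ≤ o)
m≤o∸n⇔m+n≤o m n≤o = mk⇔ (m≤o∸n⇒m+n≤o m n≤o) (m+n≤o⇒m≤o∸n m)

m<o∸n⇔m+n<o : ∀ m n o → (m < o ∸ n) ⇔ (m + n < o)
m<o∸n⇔m+n<o m n o = mk⇔ (λ m<o∸n → m≤o∸n⇒m+n≤o (suc m) (<⇒≤ (m∸n≢0⇒n<m (m>n⇒m∸n≢0 (≤-trans (s≤s z≤n) m<o∸n)))) m<o∸n)
                         (m+n≤o⇒m≤o∸n (suc m))

+≡⇔ : ∀ a w n → (a + w ≡ n) ⇔ (a ≤ n × w ≡ n ∸ a)
+≡⇔ a w n = mk⇔ (λ { refl → m≤m+n a w , sym (m+n∸m≡n a w) }) (λ (a≤n , w≡) → trans (cong (a +_) w≡) (m+[n∸m]≡n a≤n))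

+≤⇔ : ∀ a w n → (a + w ≤ n) ⇔ (a ≤ n × w ≤ n ∸ a)
+≤⇔ a w n = mk⇔ (λ a+w≤n → m+n≤o⇒m≤o a a+w≤n , m+n≤o⇒m≤o∸n w (subst (_≤ n) (+-comm a w) a+w≤n))
                (λ (a≤n , w≤) → subst (_≤ n) (+-comm w a) (m≤o∸n⇒m+n≤o w a≤n w≤))

m≤⌊n/2⌋⇔m+m≤n : ∀ m n → (m ≤ ⌊ n /2⌋) ⇔ (m + m ≤ n)
m≤⌊n/2⌋⇔m+m≤n m n = mk⇔
  (λ m≤⌊n/2⌋ → ≤-trans (+-mono-≤ m≤⌊n/2⌋ (≤-trans m≤⌊n/2⌋ (⌊n/2⌋≤⌈n/2⌉ n))) (≤-reflexive (⌊n/2⌋+⌈n/2⌉≡n n)))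
  (λ m+m≤n → subst (_≤ ⌊ n /2⌋) (sym (n≡⌊n+n/2⌋ m)) (⌊n/2⌋-mono m+m≤n))

⌊[n∸[m+m]]/2⌋≡⌊n/2⌋∸m : ∀ n m → ⌊ n ∸ (m + m) /2⌋ ≡ ⌊ n /2⌋ ∸ m
⌊[n∸[m+m]]/2⌋≡⌊n/2⌋∸m n             zero    = refl
⌊[n∸[m+m]]/2⌋≡⌊n/2⌋∸m zero          (suc m) = refl
⌊[n∸[m+m]]/2⌋≡⌊n/2⌋∸m (suc zero)    (suc m) = cong ⌊_/2⌋ (0∸n≡0 (m + suc m))
⌊[n∸[m+m]]/2⌋≡⌊n/2⌋∸m (suc (suc n)) (suc m) =
  trans (cong (λ k → ⌊ suc n ∸ k /2⌋) (+-suc m m)) (⌊[n∸[m+m]]/2⌋≡⌊n/2⌋∸m n m)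

n∸[1+⌊n/2⌋]≡⌊[n∸1]/2⌋ : ∀ n → n ∸ suc ⌊ n /2⌋ ≡ ⌊ n ∸ 1 /2⌋
n∸[1+⌊n/2⌋]≡⌊[n∸1]/2⌋ zero    = refl
n∸[1+⌊n/2⌋]≡⌊[n∸1]/2⌋ (suc n) = trans (cong (_∸ ⌈ n /2⌉) (sym (⌊n/2⌋+⌈n/2⌉≡n n))) (m+n∸n≡m ⌊ n /2⌋ ⌈ n /2⌉)

m≤n+o⇒n≤m+o⇒∣m-n∣≤o : ∀ {m n o} → m ≤ n + o → n ≤ m + o → ∣ m - n ∣ ≤ o
m≤n+o⇒n≤m+o⇒∣m-n∣≤o {m} {n} {o} m≤n+o n≤m+o with ≤-total m n
... | inj₁ m≤n = subst (_≤ o) (sym (m≤n⇒∣m-n∣≡n∸m m≤n)) (m≤n+o⇒m∸n≤o n m n≤m+o)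
... | inj₂ n≤m = subst (_≤ o) (sym (m≤n⇒∣n-m∣≡n∸m n≤m)) (m≤n+o⇒m∸n≤o m n m≤n+o)

∣n+m-o+m∣≡∣n-o∣ : ∀ m n o → ∣ n + m - o + m ∣ ≡ ∣ n - o ∣
∣n+m-o+m∣≡∣n-o∣ m n o = trans (cong₂ ∣_-_∣ (+-comm n m) (+-comm o m)) (∣m+n-m+o∣≡∣n-o∣ m n o)

∣m+n-o+p∣≤∣m-o∣+∣n-p∣ : ∀ m n o p → ∣ m + n - o + p ∣ ≤ ∣ m - o ∣ + ∣ n - p ∣
∣m+n-o+p∣≤∣m-o∣+∣n-p∣ m n o p = begin
  ∣ m + n - o + p ∣                       ≤⟨ ∣-∣-triangle (m + n) (o + n) (o + p) ⟩
  ∣ m + n - o + n ∣ + ∣ o + n - o + p ∣   ≡⟨ cong₂ _+_ (∣n+m-o+m∣≡∣n-o∣ n m o) (∣m+n-m+o∣≡∣n-o∣ o n p) ⟩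
  ∣ m - o ∣ + ∣ n - p ∣                   ∎
  where open ≤-Reasoning

∣m-o∣≤∣m+n-o+p∣+∣n-p∣ : ∀ m n o p → ∣ m - o ∣ ≤ ∣ m + n - o + p ∣ + ∣ n - p ∣
∣m-o∣≤∣m+n-o+p∣+∣n-p∣ m n o p = begin
  ∣ m - o ∣                               ≡⟨ ∣n+m-o+m∣≡∣n-o∣ n m o ⟨
  ∣ m + n - o + n ∣                       ≤⟨ ∣-∣-triangle (m + n) (o + p) (o + n) ⟩
  ∣ m + n - o + p ∣ + ∣ o + p - o + n ∣   ≡⟨ cong (∣ m + n - o + p ∣ +_) (trans (∣m+n-m+o∣≡∣n-o∣ o p n) (∣-∣-comm p n)) ⟩
  ∣ m + n - o + p ∣ + ∣ n - p ∣           ∎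
  where open ≤-Reasoning

^-distribʳ-* : ∀ m n d → (m * n) ^ d ≡ m ^ d * n ^ d
^-distribʳ-* m n zero    = refl
^-distribʳ-* m n (suc d) = trans (cong (m * n *_) (^-distribʳ-* m n d)) (*-CS.interchange m n (m ^ d) (n ^ d))

binomial-lower : ∀ y a d → y ^ suc d + suc d * a * y ^ d ≤ (y + a) ^ suc d
binomial-lower y a zero    = ≤-reflexive (base y a)
  where
  base : ∀ y a → y * 1 + 1 * a * 1 ≡ (y + a) * 1
  base = solve-∀
binomial-lower y a (suc d) = begin
  y * y ^ suc d + suc (suc d) * a * y ^ suc d                           ≤⟨ m≤m+n _ (suc d * a * a * y ^ d) ⟩
  y * y ^ suc d + suc (suc d) * a * y ^ suc d + suc d * a * a * y ^ d   ≡⟨ expand y a d (y ^ d) ⟩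
  (y + a) * (y ^ suc d + suc d * a * y ^ d)                             ≤⟨ *-monoʳ-≤ (y + a) (binomial-lower y a d) ⟩
  (y + a) * (y + a) ^ suc d                                             ∎
  where
  open ≤-Reasoning
  expand : ∀ y a d Y → y * (y * Y) + suc (suc d) * a * (y * Y) + suc d * a * a * Y ≡ (y + a) * (y * Y + suc d * a * Y)
  expand = solve-∀

binomial-upper : ∀ y a d → (y + a) ^ suc d ≤ y ^ suc d + suc d * a * (y + a) ^ d
binomial-upper y a zero    = ≤-reflexive (base y a)
  where
  base : ∀ y a → (y + a) * 1 ≡ y * 1 + 1 * a * 1
  base = solve-∀
binomial-upper y a (suc d) = begin
  (y + a) * Z                                              ≡⟨ *-distribʳ-+ Z y a ⟩
  y * Z + a * Z                                            ≤⟨ +-monoˡ-≤ (a * Z) (*-monoʳ-≤ y (binomial-upper y a d)) ⟩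
  y * (y ^ suc d + suc d * a * (y + a) ^ d) + a * Z        ≡⟨ distribute y a d (y ^ suc d) ((y + a) ^ d) Z ⟩
  y * y ^ suc d + suc d * a * (y * (y + a) ^ d) + a * Z    ≤⟨ +-monoˡ-≤ (a * Z) (+-monoʳ-≤ (y * y ^ suc d)
                                                               (*-monoʳ-≤ (suc d * a) (*-monoˡ-≤ ((y + a) ^ d) (m≤m+n y a)))) ⟩
  y * y ^ suc d + suc d * a * Z + a * Z                    ≡⟨ collect (y * y ^ suc d) a d Z ⟩
  y * y ^ suc d + suc (suc d) * a * Z                      ∎
  where
  open ≤-Reasoning
  Z : ℕ
  Z = (y + a) ^ suc d
  distribute : ∀ y a d Y W Z → y * (Y + suc d * a * W) + a * Z ≡ y * Y + suc d * a * (y * W) + a * Z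
  distribute = solve-∀
  collect : ∀ P a d Z → P + suc d * a * Z + a * Z ≡ P + suc (suc d) * a * Z
  collect = solve-∀

-- Finite sums and Iverson brackets

∑< : ℕ → (ℕ → ℕ) → ℕ
∑< M f = sum (applyUpTo f M)

syntax ∑< M (λ j → e) = ∑[ j < M ] e

∑-cong : ∀ M {f g : ℕ → ℕ} → (∀ j → f j ≡ g j) → ∑< M f ≡ ∑< M g
∑-cong zero    f≗g = refl
∑-cong (suc M) f≗g = cong₂ _+_ (f≗g 0) (∑-cong M (f≗g ∘ suc))

∑-zero : ∀ M {f : ℕ → ℕ} → (∀ j → f j ≡ 0) → ∑< M f ≡ 0
∑-zero zero    f≗0 = refl
∑-zero (suc M) f≗0 = cong₂ _+_ (f≗0 0) (∑-zero M (f≗0 ∘ suc))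

∑-≤-const : ∀ M c {f : ℕ → ℕ} → (∀ j → f j ≤ c) → ∑< M f ≤ M * c
∑-≤-const zero    c f≤c = z≤n
∑-≤-const (suc M) c f≤c = +-mono-≤ (f≤c 0) (∑-≤-const M c (f≤c ∘ suc))

∑-distrib-+ : ∀ M (f g : ℕ → ℕ) → ∑[ j < M ] (f j + g j) ≡ ∑< M f + ∑< M g
∑-distrib-+ zero    f g = refl
∑-distrib-+ (suc M) f g = begin
  f 0 + g 0 + ∑[ j < M ] (f (suc j) + g (suc j))       ≡⟨ cong (f 0 + g 0 +_) (∑-distrib-+ M (f ∘ suc) (g ∘ suc)) ⟩
  f 0 + g 0 + (∑< M (f ∘ suc) + ∑< M (g ∘ suc))        ≡⟨ +-CS.interchange (f 0) (g 0) _ _ ⟩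
  f 0 + ∑< M (f ∘ suc) + (g 0 + ∑< M (g ∘ suc))        ∎
  where open ≡-Reasoning

∑-distribˡ-* : ∀ M c (f : ℕ → ℕ) → ∑[ j < M ] (c * f j) ≡ c * ∑< M f
∑-distribˡ-* zero    c f = sym (*-zeroʳ c)
∑-distribˡ-* (suc M) c f = trans (cong (c * f 0 +_) (∑-distribˡ-* M c (f ∘ suc))) (sym (*-distribˡ-+ c (f 0) _))

∑-comm : ∀ M N (f : ℕ → ℕ → ℕ) → ∑[ i < M ] ∑[ j < N ] f i j ≡ ∑[ j < N ] ∑[ i < M ] f i j
∑-comm zero    N f = sym (∑-zero N (λ _ → refl))
∑-comm (suc M) N f = begin
  ∑[ j < N ] f 0 j + ∑[ i < M ] ∑[ j < N ] f (suc i) j   ≡⟨ cong (∑[ j < N ] f 0 j +_) (∑-comm M N (f ∘ suc)) ⟩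
  ∑[ j < N ] f 0 j + ∑[ j < N ] ∑[ i < M ] f (suc i) j   ≡⟨ ∑-distrib-+ N (f 0) (λ j → ∑[ i < M ] f (suc i) j) ⟨
  ∑[ j < N ] (f 0 j + ∑[ i < M ] f (suc i) j)            ∎
  where open ≡-Reasoning

∑-extend : ∀ {M N} {f : ℕ → ℕ} → M ≤ N → (∀ j → M ≤ j → f j ≡ 0) → ∑< M f ≡ ∑< N f
∑-extend {N = N} z≤n       f≡0 = sym (∑-zero N (λ j → f≡0 j z≤n))
∑-extend         (s≤s M≤N) f≡0 = cong (_ +_) (∑-extend M≤N (λ j M≤j → f≡0 (suc j) (s≤s M≤j)))

∑-∣-∣ : ∀ M (f g : ℕ → ℕ) → ∣ ∑< M f - ∑< M g ∣ ≤ ∑[ j < M ] ∣ f j - g j ∣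
∑-∣-∣ zero    f g = z≤n
∑-∣-∣ (suc M) f g = ≤-trans (∣m+n-o+p∣≤∣m-o∣+∣n-p∣ (f 0) _ (g 0) _) (+-monoʳ-≤ ∣ f 0 - g 0 ∣ (∑-∣-∣ M (f ∘ suc) (g ∘ suc)))

-- Defined through the boolean alone, so that ⟦ suc j ≟ suc a ⟧ and ⟦ j ≟ a ⟧ are definitionally equal.
⟦_⟧ : ∀ {p} {P : Set p} → Dec P → ℕ
⟦ P? ⟧ = if does P? then 1 else 0

⟦⟧-yes : ∀ {p} {P : Set p} → P → (P? : Dec P) → ⟦ P? ⟧ ≡ 1
⟦⟧-yes p (yes _) = refl
⟦⟧-yes p (no ¬p) = contradiction p ¬p

⟦⟧-no : ∀ {p} {P : Set p} → ¬ P → (P? : Dec P) → ⟦ P? ⟧ ≡ 0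
⟦⟧-no ¬p (no _)  = refl
⟦⟧-no ¬p (yes p) = contradiction p ¬p

⟦⟧≤1 : ∀ {p} {P : Set p} (P? : Dec P) → ⟦ P? ⟧ ≤ 1
⟦⟧≤1 (yes _) = ≤-refl
⟦⟧≤1 (no  _) = z≤n

⟦⟧-cong : ∀ {p q} {P : Set p} {Q : Set q} → P ⇔ Q → (P? : Dec P) (Q? : Dec Q) → ⟦ P? ⟧ ≡ ⟦ Q? ⟧
⟦⟧-cong P⇔Q (yes p) Q? = sym (⟦⟧-yes (Equivalence.to P⇔Q p) Q?)
⟦⟧-cong P⇔Q (no ¬p) Q? = sym (⟦⟧-no (¬p ∘ Equivalence.from P⇔Q) Q?)

⟦⟧-× : ∀ {p q} {P : Set p} {Q : Set q} (P? : Dec P) (Q? : Dec Q) → ⟦ P? ⟧ * ⟦ Q? ⟧ ≡ ⟦ P? ×-dec Q? ⟧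
⟦⟧-× (yes _) (yes _) = refl
⟦⟧-× (yes _) (no  _) = refl
⟦⟧-× (no  _) Q?      = refl

⟦⟧-*-cong : ∀ {p} {P : Set p} (P? : Dec P) {x y} → (P → x ≡ y) → ⟦ P? ⟧ * x ≡ ⟦ P? ⟧ * y
⟦⟧-*-cong (yes p) x≡y = cong (_+ 0) (x≡y p)
⟦⟧-*-cong (no  _) x≡y = refl

⟦⟧-*-≤ : ∀ {p} {P : Set p} (P? : Dec P) {x y} → (P → x ≤ y) → ⟦ P? ⟧ * x ≤ y
⟦⟧-*-≤ (yes p) x≤y = ≤-trans (≤-reflexive (+-identityʳ _)) (x≤y p)
⟦⟧-*-≤ (no  _) x≤y = z≤n

⟦+≟⟧ : ∀ a w n → ⟦ a + w ≟ n ⟧ ≡ ⟦ a ≤? n ⟧ * ⟦ w ≟ n ∸ a ⟧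
⟦+≟⟧ a w n = trans (⟦⟧-cong (+≡⇔ a w n) (a + w ≟ n) (a ≤? n ×-dec w ≟ n ∸ a)) (sym (⟦⟧-× (a ≤? n) (w ≟ n ∸ a)))

⟦+≤⟧ : ∀ a w n → ⟦ a + w ≤? n ⟧ ≡ ⟦ a ≤? n ⟧ * ⟦ w ≤? n ∸ a ⟧
⟦+≤⟧ a w n = trans (⟦⟧-cong (+≤⇔ a w n) (a + w ≤? n) (a ≤? n ×-dec w ≤? n ∸ a)) (sym (⟦⟧-× (a ≤? n) (w ≤? n ∸ a)))

∑-⟦≟⟧ : ∀ {M} a (f : ℕ → ℕ) → a < M → ∑[ j < M ] (⟦ j ≟ a ⟧ * f j) ≡ f a
∑-⟦≟⟧ {suc M} zero    f _         = trans (cong₂ _+_ (+-identityʳ (f 0)) (∑-zero M (λ _ → refl))) (+-identityʳ (f 0))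
∑-⟦≟⟧ {suc M} (suc a) f (s≤s a<M) = ∑-⟦≟⟧ a (f ∘ suc) a<M

∑-⟦+≟⟧ : ∀ {M} X N (f : ℕ → ℕ) → N < M → ∑[ j < M ] (⟦ j * 1 + X ≟ N ⟧ * f j) ≡ ⟦ X ≤? N ⟧ * f (N ∸ X)
∑-⟦+≟⟧ {M} X N f N<M = begin
  ∑[ j < M ] (⟦ j * 1 + X ≟ N ⟧ * f j)             ≡⟨ ∑-cong M split ⟩
  ∑[ j < M ] (⟦ X ≤? N ⟧ * (⟦ j ≟ N ∸ X ⟧ * f j))  ≡⟨ ∑-distribˡ-* M ⟦ X ≤? N ⟧ _ ⟩
  ⟦ X ≤? N ⟧ * ∑[ j < M ] (⟦ j ≟ N ∸ X ⟧ * f j)    ≡⟨ cong (⟦ X ≤? N ⟧ *_) (∑-⟦≟⟧ (N ∸ X) f (≤-<-trans (m∸n≤m N X) N<M)) ⟩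
  ⟦ X ≤? N ⟧ * f (N ∸ X)                           ∎
  where
  open ≡-Reasoning
  split : ∀ j → ⟦ j * 1 + X ≟ N ⟧ * f j ≡ ⟦ X ≤? N ⟧ * (⟦ j ≟ N ∸ X ⟧ * f j)
  split j = begin
    ⟦ j * 1 + X ≟ N ⟧ * f j                 ≡⟨ cong (λ x → ⟦ x ≟ N ⟧ * f j) (trans (cong (_+ X) (*-identityʳ j)) (+-comm j X)) ⟩
    ⟦ X + j ≟ N ⟧ * f j                     ≡⟨ cong (_* f j) (⟦+≟⟧ X j N) ⟩
    ⟦ X ≤? N ⟧ * ⟦ j ≟ N ∸ X ⟧ * f j        ≡⟨ *-assoc ⟦ X ≤? N ⟧ _ _ ⟩
    ⟦ X ≤? N ⟧ * (⟦ j ≟ N ∸ X ⟧ * f j)      ∎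

∑-⟦<⟧ : ∀ M a → ∑[ j < M ] ⟦ j <? a ⟧ ≡ M ⊓ a
∑-⟦<⟧ zero    a       = refl
∑-⟦<⟧ (suc M) zero    = ∑-zero M (λ _ → refl)
∑-⟦<⟧ (suc M) (suc a) = cong suc (∑-⟦<⟧ M a)

∑-⟦<⟧-≤ : ∀ {M t} → t ≤ M → ∑[ j < M ] ⟦ j <? t ⟧ ≡ t
∑-⟦<⟧-≤ {M} {t} t≤M = trans (∑-⟦<⟧ M t) (m≥n⇒m⊓n≡n t≤M)

-- Counting partitions by sums over boxes

length≡sum-map-1 : ∀ {A : Set} (xs : List A) → length xs ≡ sum (map (λ _ → 1) xs)
length≡sum-map-1 []       = refl
length≡sum-map-1 (x ∷ xs) = cong suc (length≡sum-map-1 xs)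

length-filter≡sum-map-⟦⟧ : ∀ {A : Set} {P : A → Set} (P? : ∀ x → Dec (P x)) (xs : List A) →
                           length (filter P? xs) ≡ sum (map (λ x → ⟦ P? x ⟧) xs)
length-filter≡sum-map-⟦⟧ P? []       = refl
length-filter≡sum-map-⟦⟧ P? (x ∷ xs) with P? x
... | yes _ = cong suc (length-filter≡sum-map-⟦⟧ P? xs)
... | no  _ = length-filter≡sum-map-⟦⟧ P? xs

sum-map-filter : ∀ {A : Set} {P : A → Set} (P? : ∀ x → Dec (P x)) (φ : A → ℕ) (xs : List A) →
                 sum (map φ (filter P? xs)) ≡ sum (map (λ x → ⟦ P? x ⟧ * φ x) xs)
sum-map-filter P? φ []       = refl
sum-map-filter P? φ (x ∷ xs) with P? x
... | yes _ = cong₂ _+_ (sym (+-identityʳ (φ x))) (sum-map-filter P? φ xs)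
... | no  _ = sum-map-filter P? φ xs

sum-map-concatMap : ∀ {A B : Set} (φ : B → ℕ) (g : A → List B) (xs : List A) →
                    sum (map φ (concatMap g xs)) ≡ sum (map (λ x → sum (map φ (g x))) xs)
sum-map-concatMap φ g []       = refl
sum-map-concatMap φ g (x ∷ xs) = begin
  sum (map φ (g x ++ concatMap g xs))                 ≡⟨ cong sum (map-++ φ (g x) (concatMap g xs)) ⟩
  sum (map φ (g x) ++ map φ (concatMap g xs))         ≡⟨ sum-++ (map φ (g x)) _ ⟩
  sum (map φ (g x)) + sum (map φ (concatMap g xs))    ≡⟨ cong (sum (map φ (g x)) +_) (sum-map-concatMap φ g xs) ⟩
  sum (map φ (g x)) + sum (map (λ x → sum (map φ (g x))) xs) ∎
  where open ≡-Reasoning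

Positive : List ℕ → Set
Positive = All (1 ≤_)

weight : List ℕ → List ℕ → ℕ
weight []       c       = 0
weight (d ∷ ds) []      = 0
weight (d ∷ ds) (x ∷ c) = x * d + weight ds c

∑box : ℕ → ℕ → (List ℕ → ℕ) → ℕ
∑box zero    B H = H []
∑box (suc m) B H = ∑[ j < suc B ] ∑box m B (λ c → H (j ∷ c))

∑box-cong : ∀ m B {H H′ : List ℕ → ℕ} → (∀ c → H c ≡ H′ c) → ∑box m B H ≡ ∑box m B H′
∑box-cong zero    B H≗H′ = H≗H′ []
∑box-cong (suc m) B H≗H′ = ∑-cong (suc B) (λ j → ∑box-cong m B (λ c → H≗H′ (j ∷ c)))

∑box-zero : ∀ m B {H : List ℕ → ℕ} → (∀ c → H c ≡ 0) → ∑box m B H ≡ 0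
∑box-zero zero    B H≗0 = H≗0 []
∑box-zero (suc m) B H≗0 = ∑-zero (suc B) (λ j → ∑box-zero m B (λ c → H≗0 (j ∷ c)))

∑box-distribˡ-* : ∀ m B k (H : List ℕ → ℕ) → ∑box m B (λ c → k * H c) ≡ k * ∑box m B H
∑box-distribˡ-* zero    B k H = refl
∑box-distribˡ-* (suc m) B k H =
  trans (∑-cong (suc B) (λ j → ∑box-distribˡ-* m B k (λ c → H (j ∷ c))))
        (∑-distribˡ-* (suc B) k (λ j → ∑box m B (λ c → H (j ∷ c))))

∑box-distrib-+ : ∀ m B (H H′ : List ℕ → ℕ) → ∑box m B (λ c → H c + H′ c) ≡ ∑box m B H + ∑box m B H′
∑box-distrib-+ zero    B H H′ = refl
∑box-distrib-+ (suc m) B H H′ =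
  trans (∑-cong (suc B) (λ j → ∑box-distrib-+ m B (λ c → H (j ∷ c)) (λ c → H′ (j ∷ c))))
        (∑-distrib-+ (suc B) (λ j → ∑box m B (λ c → H (j ∷ c))) (λ j → ∑box m B (λ c → H′ (j ∷ c))))

∑-∑box-comm : ∀ M m B (F : ℕ → List ℕ → ℕ) → ∑[ j < M ] ∑box m B (F j) ≡ ∑box m B (λ c → ∑[ j < M ] F j c)
∑-∑box-comm M zero    B F = refl
∑-∑box-comm M (suc m) B F =
  trans (∑-comm M (suc B) (λ j i → ∑box m B (λ c → F j (i ∷ c))))
        (∑-cong (suc B) (λ i → ∑-∑box-comm M m B (λ j c → F j (i ∷ c))))

∑∑-∑box-comm : ∀ M N m B (F : ℕ → ℕ → List ℕ → ℕ) →
  ∑[ i < M ] ∑[ j < N ] ∑box m B (F i j) ≡ ∑box m B (λ c → ∑[ i < M ] ∑[ j < N ] F i j c)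
∑∑-∑box-comm M N m B F =
  trans (∑-cong M (λ i → ∑-∑box-comm N m B (F i))) (∑-∑box-comm M m B (λ i c → ∑[ j < N ] F i j c))

sum-map-multVecs-∷ : ∀ (φ : List ℕ → ℕ) d ds n →
  sum (map φ (multVecs (d ∷ ds) n)) ≡ ∑[ j < suc n ] (⟦ j * d ≤? n ⟧ * sum (map (φ ∘ (j ∷_)) (multVecs ds (n ∸ j * d))))
sum-map-multVecs-∷ φ d ds n = begin
  sum (map φ (concatMap block (filter fits js)))              ≡⟨ sum-map-concatMap φ block (filter fits js) ⟩
  sum (map (sum ∘ map φ ∘ block) (filter fits js))            ≡⟨ sum-map-filter fits (sum ∘ map φ ∘ block) js ⟩
  sum (map (λ j → ⟦ fits j ⟧ * sum (map φ (block j))) js)     ≡⟨ cong sum (map-upTo (λ j → ⟦ fits j ⟧ * sum (map φ (block j))) (suc n)) ⟩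
  ∑[ j < suc n ] (⟦ fits j ⟧ * sum (map φ (block j)))
    ≡⟨ ∑-cong (suc n) (λ j → cong (λ x → ⟦ fits j ⟧ * sum x) (sym (map-∘ {g = φ} {f = j ∷_} (multVecs ds (n ∸ j * d))))) ⟩
  ∑[ j < suc n ] (⟦ fits j ⟧ * sum (map (φ ∘ (j ∷_)) (multVecs ds (n ∸ j * d)))) ∎
  where
  open ≡-Reasoning
  js : List ℕ
  js = upTo (suc n)
  fits : ∀ j → Dec (j * d ≤ n)
  fits j = j * d ≤? n
  block : ℕ → List (List ℕ)
  block j = map (j ∷_) (multVecs ds (n ∸ j * d))

sum-map-multVecs : ∀ ds → Positive ds → ∀ (φ : List ℕ → ℕ) {n B} → n ≤ B →
  sum (map φ (multVecs ds n)) ≡ ∑box (length ds) B (λ c → ⟦ weight ds c ≟ n ⟧ * φ c)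
sum-map-multVecs []       []          φ {zero}  _   = refl
sum-map-multVecs []       []          φ {suc n} _   = refl
sum-map-multVecs (d ∷ ds) (1≤d ∷ ds⁺) φ {n} {B} n≤B = begin
  sum (map φ (multVecs (d ∷ ds) n))
    ≡⟨ sum-map-multVecs-∷ φ d ds n ⟩
  ∑[ j < suc n ] (⟦ j * d ≤? n ⟧ * sum (map (φ ∘ (j ∷_)) (multVecs ds (n ∸ j * d))))
    ≡⟨ ∑-cong (suc n) (λ j → cong (⟦ j * d ≤? n ⟧ *_)
         (sum-map-multVecs ds ds⁺ (φ ∘ (j ∷_)) (≤-trans (m∸n≤m n (j * d)) n≤B))) ⟩
  ∑[ j < suc n ] (⟦ j * d ≤? n ⟧ * ∑box m B (λ c → ⟦ weight ds c ≟ n ∸ j * d ⟧ * φ (j ∷ c)))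
    ≡⟨ ∑-cong (suc n) (λ j → sym (∑box-distribˡ-* m B ⟦ j * d ≤? n ⟧ (λ c → ⟦ weight ds c ≟ n ∸ j * d ⟧ * φ (j ∷ c)))) ⟩
  ∑[ j < suc n ] ∑box m B (λ c → ⟦ j * d ≤? n ⟧ * (⟦ weight ds c ≟ n ∸ j * d ⟧ * φ (j ∷ c)))
    ≡⟨ ∑-cong (suc n) (λ j → ∑box-cong m B (λ c → merge (j * d) (weight ds c) (φ (j ∷ c)))) ⟩
  ∑[ j < suc n ] ∑box m B (λ c → ⟦ j * d + weight ds c ≟ n ⟧ * φ (j ∷ c))
    ≡⟨ ∑-extend (s≤s n≤B) (λ j n<j → ∑box-zero m B (λ c → cong (_* φ (j ∷ c)) (⟦⟧-no (too-big n<j) (j * d + weight ds c ≟ n)))) ⟩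
  ∑[ j < suc B ] ∑box m B (λ c → ⟦ j * d + weight ds c ≟ n ⟧ * φ (j ∷ c)) ∎
  where
  open ≡-Reasoning
  m : ℕ
  m = length ds
  merge : ∀ a w x → ⟦ a ≤? n ⟧ * (⟦ w ≟ n ∸ a ⟧ * x) ≡ ⟦ a + w ≟ n ⟧ * x
  merge a w x = trans (sym (*-assoc ⟦ a ≤? n ⟧ _ x)) (cong (_* x) (sym (⟦+≟⟧ a w n)))
  too-big : ∀ {j w} → n < j → j * d + w ≢ n
  too-big {j} {w} n<j refl = <⇒≱ n<j (≤-trans (m≤m*n j d {{>-nonZero 1≤d}}) (m≤m+n (j * d) w))

-- Partitions of n with parts from 1 ∷ L, i.e. partitions of size at most n with parts from L.
p≤ : List ℕ → ℕ → ℕ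
p≤ L n = length (multVecs (1 ∷ L) n)

p≤-∑box : ∀ L → Positive L → ∀ {n B} → n ≤ B → p≤ L n ≡ ∑box (length L) B (λ c → ⟦ weight L c ≤? n ⟧)
p≤-∑box L L⁺ {n} {B} n≤B = begin
  length (multVecs (1 ∷ L) n)
    ≡⟨ length≡sum-map-1 (multVecs (1 ∷ L) n) ⟩
  sum (map (λ _ → 1) (multVecs (1 ∷ L) n))
    ≡⟨ sum-map-multVecs (1 ∷ L) (≤-refl ∷ L⁺) (λ _ → 1) n≤B ⟩
  ∑[ j < suc B ] ∑box m B (λ c → ⟦ j * 1 + weight L c ≟ n ⟧ * 1)
    ≡⟨ ∑-∑box-comm (suc B) m B (λ j c → ⟦ j * 1 + weight L c ≟ n ⟧ * 1) ⟩
  ∑box m B (λ c → ∑[ j < suc B ] (⟦ j * 1 + weight L c ≟ n ⟧ * 1))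
    ≡⟨ ∑box-cong m B (λ c → ∑-⟦+≟⟧ (weight L c) n (λ _ → 1) (s≤s n≤B)) ⟩
  ∑box m B (λ c → ⟦ weight L c ≤? n ⟧ * 1)
    ≡⟨ ∑box-cong m B (λ c → *-identityʳ ⟦ weight L c ≤? n ⟧) ⟩
  ∑box m B (λ c → ⟦ weight L c ≤? n ⟧) ∎
  where
  open ≡-Reasoning
  m : ℕ
  m = length L

p≤-[] : ∀ n → p≤ [] n ≡ 1
p≤-[] n = p≤-∑box [] [] (≤-refl {n})

conv : ℕ → (ℕ → ℕ) → ℕ → ℕ
conv a h n = ∑[ j < suc n ] (⟦ j * a ≤? n ⟧ * h (n ∸ j * a))

p≤-∷ : ∀ a L → Positive (a ∷ L) → ∀ n → p≤ (a ∷ L) n ≡ conv a (p≤ L) n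
p≤-∷ a L (1≤a ∷ L⁺) n = begin
  p≤ (a ∷ L) n
    ≡⟨ p≤-∑box (a ∷ L) (1≤a ∷ L⁺) ≤-refl ⟩
  ∑[ j < suc n ] ∑box m n (λ c → ⟦ j * a + weight L c ≤? n ⟧)
    ≡⟨ ∑-cong (suc n) (λ j → ∑box-cong m n (λ c → ⟦+≤⟧ (j * a) (weight L c) n)) ⟩
  ∑[ j < suc n ] ∑box m n (λ c → ⟦ j * a ≤? n ⟧ * ⟦ weight L c ≤? n ∸ j * a ⟧)
    ≡⟨ ∑-cong (suc n) (λ j → ∑box-distribˡ-* m n ⟦ j * a ≤? n ⟧ (λ c → ⟦ weight L c ≤? n ∸ j * a ⟧)) ⟩
  ∑[ j < suc n ] (⟦ j * a ≤? n ⟧ * ∑box m n (λ c → ⟦ weight L c ≤? n ∸ j * a ⟧))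
    ≡⟨ ∑-cong (suc n) (λ j → cong (⟦ j * a ≤? n ⟧ *_) (sym (p≤-∑box L L⁺ (m∸n≤m n (j * a))))) ⟩
  conv a (p≤ L) n ∎
  where
  open ≡-Reasoning
  m : ℕ
  m = length L

-- The counting identity

pair-count-identity : ∀ r s → (suc ⌊ r /2⌋ ⊓ (r ∸ s)) + ⌊ r ∸ suc (s + s) /2⌋ ≡ r ∸ s
pair-count-identity r s = begin
  (suc ⌊ r /2⌋ ⊓ (r ∸ s)) + ⌊ r ∸ suc (s + s) /2⌋   ≡⟨ cong (suc ⌊ r /2⌋ ⊓ (r ∸ s) +_) reflected ⟩
  (suc ⌊ r /2⌋ ⊓ (r ∸ s)) + (r ∸ s ∸ suc ⌊ r /2⌋)   ≡⟨ m⊓n+n∸m≡n (suc ⌊ r /2⌋) (r ∸ s) ⟩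
  r ∸ s                                             ∎
  where
  open ≡-Reasoning
  reflected : ⌊ r ∸ suc (s + s) /2⌋ ≡ r ∸ s ∸ suc ⌊ r /2⌋
  reflected = begin
    ⌊ r ∸ suc (s + s) /2⌋   ≡⟨ cong ⌊_/2⌋ (∸-+-assoc r 1 (s + s)) ⟨
    ⌊ r ∸ 1 ∸ (s + s) /2⌋   ≡⟨ ⌊[n∸[m+m]]/2⌋≡⌊n/2⌋∸m (r ∸ 1) s ⟩
    ⌊ r ∸ 1 /2⌋ ∸ s         ≡⟨ cong (_∸ s) (n∸[1+⌊n/2⌋]≡⌊[n∸1]/2⌋ r) ⟨
    r ∸ suc ⌊ r /2⌋ ∸ s     ≡⟨ ∸-+-assoc r (suc ⌊ r /2⌋) s ⟩
    r ∸ (suc ⌊ r /2⌋ + s)   ≡⟨ cong (r ∸_) (+-comm (suc ⌊ r /2⌋) s) ⟩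
    r ∸ (s + suc ⌊ r /2⌋)   ≡⟨ ∸-+-assoc r s (suc ⌊ r /2⌋) ⟨
    r ∸ s ∸ suc ⌊ r /2⌋     ∎

count-S+1 : ∀ n w s → 1 ≤ n → ∑[ j < suc n ] (⟦ j * 1 + (w + 1 * s) ≤? n ∸ 1 ⟧ * 1) ≡ n ∸ w ∸ s
count-S+1 n w s 1≤n = trans (∑-cong (suc n) bracket) (∑-⟦<⟧-≤ (≤-trans (m∸n≤m (n ∸ w) s) (≤-trans (m∸n≤m n w) (n≤1+n n))))
  where
  bracket : ∀ j → ⟦ j * 1 + (w + 1 * s) ≤? n ∸ 1 ⟧ * 1 ≡ ⟦ j <? n ∸ w ∸ s ⟧
  bracket j = trans (*-identityʳ _) (⟦⟧-cong equiv (j * 1 + (w + 1 * s) ≤? n ∸ 1) (j <? n ∸ w ∸ s))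
    where
    open ⇔-Reasoning
    eq : ∀ j w s → j * 1 + (w + 1 * s) + 1 ≡ suc (j + s + w)
    eq = solve-∀
    equiv : (j * 1 + (w + 1 * s) ≤ n ∸ 1) ⇔ (j < n ∸ w ∸ s)
    equiv = begin
      j * 1 + (w + 1 * s) ≤ n ∸ 1   ≈⟨ m≤o∸n⇔m+n≤o _ 1≤n ⟩
      j * 1 + (w + 1 * s) + 1 ≤ n   ≡⟨ cong (_≤ n) (eq j w s) ⟩
      j + s + w < n                  ≈⟨ m<o∸n⇔m+n<o (j + s) w n ⟨
      j + s < n ∸ w                  ≈⟨ m<o∸n⇔m+n<o j s (n ∸ w) ⟨
      j < n ∸ w ∸ s                  ∎

count-S+2 : ∀ n w s → 3 ≤ n → ∑[ j < suc n ] (⟦ j * 2 + (w + 2 * s) ≤? n ∸ 3 ⟧ * 1) ≡ ⌊ n ∸ w ∸ suc (s + s) /2⌋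
count-S+2 n w s 3≤n = trans (∑-cong (suc n) bracket) (∑-⟦<⟧-≤ bound)
  where
  bound : ⌊ n ∸ w ∸ suc (s + s) /2⌋ ≤ suc n
  bound = ≤-trans (⌊n/2⌋≤n _) (≤-trans (m∸n≤m (n ∸ w) (suc (s + s))) (≤-trans (m∸n≤m n w) (n≤1+n n)))
  bracket : ∀ j → ⟦ j * 2 + (w + 2 * s) ≤? n ∸ 3 ⟧ * 1 ≡ ⟦ j <? ⌊ n ∸ w ∸ suc (s + s) /2⌋ ⟧
  bracket j = trans (*-identityʳ _) (⟦⟧-cong equiv (j * 2 + (w + 2 * s) ≤? n ∸ 3) (j <? ⌊ n ∸ w ∸ suc (s + s) /2⌋))
    where
    open ⇔-Reasoning
    eq : ∀ j w s → j * 2 + (w + 2 * s) + 3 ≡ suc (j + suc j + suc (s + s) + w)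
    eq = solve-∀
    equiv : (j * 2 + (w + 2 * s) ≤ n ∸ 3) ⇔ (j < ⌊ n ∸ w ∸ suc (s + s) /2⌋)
    equiv = begin
      j * 2 + (w + 2 * s) ≤ n ∸ 3           ≈⟨ m≤o∸n⇔m+n≤o _ 3≤n ⟩
      j * 2 + (w + 2 * s) + 3 ≤ n           ≡⟨ cong (_≤ n) (eq j w s) ⟩
      j + suc j + suc (s + s) + w < n       ≈⟨ m<o∸n⇔m+n<o (j + suc j + suc (s + s)) w n ⟨
      j + suc j + suc (s + s) < n ∸ w       ≈⟨ m<o∸n⇔m+n<o (j + suc j) (suc (s + s)) (n ∸ w) ⟨
      suc j + suc j ≤ n ∸ w ∸ suc (s + s)   ≈⟨ m≤⌊n/2⌋⇔m+m≤n (suc j) _ ⟨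
      j < ⌊ n ∸ w ∸ suc (s + s) /2⌋         ∎

-- With j parts 2 and the rest of size w there are n ∸ (2j + w) parts 1.
more-R-parts⇔ : ∀ n w s j → j * 2 + w ≤ n → (s < (n ∸ (j * 2 + w)) + (j + 0)) ⇔ (j + s + w < n)
more-R-parts⇔ n w s j 2j+w≤n = mk⇔ (λ s<t → subst₂ _<_ (reorder s j w) total (+-monoˡ-< (j + w) s<t))
                                   (λ lt → +-cancelʳ-< (j + w) s _ (subst₂ _<_ (sym (reorder s j w)) (sym total) lt))
  where
  reorder : ∀ s j w → s + (j + w) ≡ j + s + w
  reorder = solve-∀
  regroup : ∀ t j w → t + (j + 0) + (j + w) ≡ t + (j * 2 + w)
  regroup = solve-∀
  total : (n ∸ (j * 2 + w)) + (j + 0) + (j + w) ≡ n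
  total = trans (regroup (n ∸ (j * 2 + w)) j w) (m∸n+n≡m 2j+w≤n)

count-R>S : ∀ n w s →
  ∑[ j < suc n ] (⟦ j * 2 + w ≤? n ⟧ * ⟦ s <? (n ∸ (j * 2 + w)) + (j + 0) ⟧) ≡ suc ⌊ n ∸ w /2⌋ ⊓ (n ∸ w ∸ s)
count-R>S n w s = trans (∑-cong (suc n) bracket) (∑-⟦<⟧-≤ bound)
  where
  r : ℕ
  r = n ∸ w
  bound : suc ⌊ r /2⌋ ⊓ (r ∸ s) ≤ suc n
  bound = ≤-trans (m⊓n≤n _ (r ∸ s)) (≤-trans (m∸n≤m r s) (≤-trans (m∸n≤m n w) (n≤1+n n)))
  bracket : ∀ j → ⟦ j * 2 + w ≤? n ⟧ * ⟦ s <? (n ∸ (j * 2 + w)) + (j + 0) ⟧ ≡ ⟦ j <? suc ⌊ r /2⌋ ⊓ (r ∸ s) ⟧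
  bracket j = trans (⟦⟧-× (j * 2 + w ≤? n) (s <? (n ∸ (j * 2 + w)) + (j + 0)))
                    (⟦⟧-cong (mk⇔ to from) (j * 2 + w ≤? n ×-dec s <? (n ∸ (j * 2 + w)) + (j + 0)) (j <? suc ⌊ r /2⌋ ⊓ (r ∸ s)))
    where
    j*2≡j+j : j * 2 ≡ j + j
    j*2≡j+j = trans (*-comm j 2) (cong (j +_) (+-identityʳ j))
    to : (j * 2 + w ≤ n) × (s < (n ∸ (j * 2 + w)) + (j + 0)) → j < suc ⌊ r /2⌋ ⊓ (r ∸ s)
    to (2j+w≤n , s<t) = ⊓-pres-m<
      (s≤s (Equivalence.from (m≤⌊n/2⌋⇔m+m≤n j r) (m+n≤o⇒m≤o∸n (j + j) (subst (λ x → x + w ≤ n) j*2≡j+j 2j+w≤n))))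
      (m+n≤o⇒m≤o∸n (suc j) (m+n≤o⇒m≤o∸n (suc j + s) (Equivalence.to (more-R-parts⇔ n w s j 2j+w≤n) s<t)))
    from : j < suc ⌊ r /2⌋ ⊓ (r ∸ s) → (j * 2 + w ≤ n) × (s < (n ∸ (j * 2 + w)) + (j + 0))
    from j<t = 2j+w≤n , Equivalence.from (more-R-parts⇔ n w s j 2j+w≤n) j+s+w<n
      where
      j+s+w<n : j + s + w < n
      j+s+w<n = Equivalence.to (m<o∸n⇔m+n<o (j + s) w n) (Equivalence.to (m<o∸n⇔m+n<o j s r) (m<n⊓o⇒m<o _ (r ∸ s) j<t))
      2j+w≤n : j * 2 + w ≤ n
      2j+w≤n = subst (λ x → x + w ≤ n) (sym j*2≡j+j)
        (m≤o∸n⇒m+n≤o (j + j) (m+n≤o⇒n≤o (suc j + s) j+s+w<n)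
          (Equivalence.to (m≤⌊n/2⌋⇔m+m≤n j r) (s≤s⁻¹ (m<n⊓o⇒m<n _ (r ∸ s) j<t))))

∑∑-⟦+≟⟧ : ∀ n N (X : ℕ → ℕ) (f : ℕ → ℕ → ℕ) → N ≤ n →
  ∑[ j₁ < suc n ] ∑[ j₂ < suc n ] (⟦ j₁ * 1 + X j₂ ≟ N ⟧ * f j₁ j₂) ≡ ∑[ j₂ < suc n ] (⟦ X j₂ ≤? N ⟧ * f (N ∸ X j₂) j₂)
∑∑-⟦+≟⟧ n N X f N≤n =
  trans (∑-comm (suc n) (suc n) (λ j₁ j₂ → ⟦ j₁ * 1 + X j₂ ≟ N ⟧ * f j₁ j₂))
        (∑-cong (suc n) (λ j₂ → ∑-⟦+≟⟧ (X j₂) N (λ j₁ → f j₁ j₂) (s≤s N≤n)))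

pair-sums-identity : ∀ n w s → 3 ≤ n →
    ∑[ j₁ < suc n ] ∑[ j₂ < suc n ] (⟦ j₁ * 1 + (j₂ * 2 + w) ≟ n ⟧ * ⟦ s <? j₁ + (j₂ + 0) ⟧)
  + ∑[ j₁ < suc n ] ∑[ j₂ < suc n ] (⟦ j₁ * 1 + (j₂ * 2 + (w + 2 * s)) ≟ n ∸ 3 ⟧ * 1)
  ≡ ∑[ j₁ < suc n ] ∑[ j₂ < suc n ] (⟦ j₁ * 1 + (j₂ * 1 + (w + 1 * s)) ≟ n ∸ 1 ⟧ * 1)
pair-sums-identity n w s 3≤n = begin
    ∑[ j₁ < suc n ] ∑[ j₂ < suc n ] (⟦ j₁ * 1 + (j₂ * 2 + w) ≟ n ⟧ * ⟦ s <? j₁ + (j₂ + 0) ⟧)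
  + ∑[ j₁ < suc n ] ∑[ j₂ < suc n ] (⟦ j₁ * 1 + (j₂ * 2 + (w + 2 * s)) ≟ n ∸ 3 ⟧ * 1)
      ≡⟨ cong₂ _+_ (∑∑-⟦+≟⟧ n n (λ j → j * 2 + w) (λ j₁ j₂ → ⟦ s <? j₁ + (j₂ + 0) ⟧) ≤-refl)
                   (∑∑-⟦+≟⟧ n (n ∸ 3) (λ j → j * 2 + (w + 2 * s)) (λ _ _ → 1) (m∸n≤m n 3)) ⟩
    ∑[ j < suc n ] (⟦ j * 2 + w ≤? n ⟧ * ⟦ s <? (n ∸ (j * 2 + w)) + (j + 0) ⟧)
  + ∑[ j < suc n ] (⟦ j * 2 + (w + 2 * s) ≤? n ∸ 3 ⟧ * 1)
      ≡⟨ cong₂ _+_ (count-R>S n w s) (count-S+2 n w s 3≤n) ⟩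
  (suc ⌊ n ∸ w /2⌋ ⊓ (n ∸ w ∸ s)) + ⌊ n ∸ w ∸ suc (s + s) /2⌋
      ≡⟨ pair-count-identity (n ∸ w) s ⟩
  n ∸ w ∸ s
      ≡⟨ count-S+1 n w s (≤-trans (s≤s z≤n) 3≤n) ⟨
  ∑[ j < suc n ] (⟦ j * 1 + (w + 1 * s) ≤? n ∸ 1 ⟧ * 1)
      ≡⟨ ∑∑-⟦+≟⟧ n (n ∸ 1) (λ j → j * 1 + (w + 1 * s)) (λ _ _ → 1) (m∸n≤m n 1) ⟨
  ∑[ j₁ < suc n ] ∑[ j₂ < suc n ] (⟦ j₁ * 1 + (j₂ * 1 + (w + 1 * s)) ≟ n ∸ 1 ⟧ * 1) ∎
  where open ≡-Reasoning

weight-shift : ∀ e S I c → weight (map (_+ e) S ++ I) c ≡ weight (S ++ I) c + e * partsS [] S c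
weight-shift e []      I c       = sym (trans (cong (weight I c +_) (*-zeroʳ e)) (+-identityʳ _))
weight-shift e (d ∷ S) I []      = sym (*-zeroʳ e)
weight-shift e (d ∷ S) I (x ∷ c) =
  trans (cong (x * (d + e) +_) (weight-shift e S I c)) (distribute x d e (weight (S ++ I) c) (partsS [] S c))
  where
  distribute : ∀ x d e W P → x * (d + e) + (W + e * P) ≡ x * d + W + e * (x + P)
  distribute = solve-∀

length-shift : ∀ e S I → length (map (_+ e) S ++ I) ≡ length (S ++ I)
length-shift e S I = trans (length-++ (map (_+ e) S)) (trans (cong (_+ length I) (length-map (_+ e) S)) (sym (length-++ S)))

Positive-shift : ∀ e {S} → Positive S → Positive (map (_+ e) S)
Positive-shift e S⁺ = AllP.map⁺ (All.map (λ {s} 1≤s → ≤-trans 1≤s (m≤m+n s e)) S⁺)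

module _ (S I : List ℕ) (S⁺ : Positive S) (I⁺ : Positive I) where

  private
    L : List ℕ
    L = S ++ I
    m : ℕ
    m = length L

  pR>S-∑box : ∀ n → pR>S (1 ∷ 2 ∷ []) S I n ≡
    ∑box m n (λ c → ∑[ j₁ < suc n ] ∑[ j₂ < suc n ] (⟦ j₁ * 1 + (j₂ * 2 + weight L c) ≟ n ⟧ * ⟦ partsS [] S c <? j₁ + (j₂ + 0) ⟧))
  pR>S-∑box n = begin
    pR>S (1 ∷ 2 ∷ []) S I n
      ≡⟨ length-filter≡sum-map-⟦⟧ more-R (multVecs (1 ∷ 2 ∷ L) n) ⟩
    sum (map (λ x → ⟦ more-R x ⟧) (multVecs (1 ∷ 2 ∷ L) n))
      ≡⟨ sum-map-multVecs (1 ∷ 2 ∷ L) (≤-refl ∷ s≤s z≤n ∷ AllP.++⁺ S⁺ I⁺) (λ x → ⟦ more-R x ⟧) ≤-refl ⟩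
    ∑[ j₁ < suc n ] ∑[ j₂ < suc n ] ∑box m n (λ c → ⟦ j₁ * 1 + (j₂ * 2 + weight L c) ≟ n ⟧ * ⟦ partsS [] S c <? j₁ + (j₂ + 0) ⟧)
      ≡⟨ ∑∑-∑box-comm (suc n) (suc n) m n (λ j₁ j₂ c → ⟦ j₁ * 1 + (j₂ * 2 + weight L c) ≟ n ⟧ * ⟦ partsS [] S c <? j₁ + (j₂ + 0) ⟧) ⟩
    ∑box m n (λ c → ∑[ j₁ < suc n ] ∑[ j₂ < suc n ] (⟦ j₁ * 1 + (j₂ * 2 + weight L c) ≟ n ⟧ * ⟦ partsS [] S c <? j₁ + (j₂ + 0) ⟧)) ∎
    where
    open ≡-Reasoning
    more-R : ∀ x → Dec (partsS (1 ∷ 2 ∷ []) S x < partsR (1 ∷ 2 ∷ []) x)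
    more-R x = partsS (1 ∷ 2 ∷ []) S x <? partsR (1 ∷ 2 ∷ []) x

  p≤-shift-∑box : ∀ e a → 1 ≤ a → ∀ {N n} → N ≤ n → p≤ (a ∷ map (_+ e) S ++ I) N ≡
    ∑box m n (λ c → ∑[ j₁ < suc n ] ∑[ j₂ < suc n ] (⟦ j₁ * 1 + (j₂ * a + (weight L c + e * partsS [] S c)) ≟ N ⟧ * 1))
  p≤-shift-∑box e a 1≤a {N} {n} N≤n = begin
    length (multVecs (1 ∷ a ∷ Lₑ) N)
      ≡⟨ length≡sum-map-1 (multVecs (1 ∷ a ∷ Lₑ) N) ⟩
    sum (map (λ _ → 1) (multVecs (1 ∷ a ∷ Lₑ) N))
      ≡⟨ sum-map-multVecs (1 ∷ a ∷ Lₑ) (≤-refl ∷ 1≤a ∷ AllP.++⁺ (Positive-shift e S⁺) I⁺) (λ _ → 1) N≤n ⟩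
    ∑[ j₁ < suc n ] ∑[ j₂ < suc n ] ∑box (length Lₑ) n (λ c → ⟦ j₁ * 1 + (j₂ * a + weight Lₑ c) ≟ N ⟧ * 1)
      ≡⟨ ∑∑-∑box-comm (suc n) (suc n) (length Lₑ) n (λ j₁ j₂ c → ⟦ j₁ * 1 + (j₂ * a + weight Lₑ c) ≟ N ⟧ * 1) ⟩
    ∑box (length Lₑ) n (λ c → ∑[ j₁ < suc n ] ∑[ j₂ < suc n ] (⟦ j₁ * 1 + (j₂ * a + weight Lₑ c) ≟ N ⟧ * 1))
      ≡⟨ cong (λ k → ∑box k n (λ c → ∑[ j₁ < suc n ] ∑[ j₂ < suc n ] (⟦ j₁ * 1 + (j₂ * a + weight Lₑ c) ≟ N ⟧ * 1))) (length-shift e S I) ⟩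
    ∑box m n (λ c → ∑[ j₁ < suc n ] ∑[ j₂ < suc n ] (⟦ j₁ * 1 + (j₂ * a + weight Lₑ c) ≟ N ⟧ * 1))
      ≡⟨ ∑box-cong m n (λ c → ∑-cong (suc n) (λ j₁ → ∑-cong (suc n) (λ j₂ →
           cong (λ x → ⟦ j₁ * 1 + (j₂ * a + x) ≟ N ⟧ * 1) (weight-shift e S I c)))) ⟩
    ∑box m n (λ c → ∑[ j₁ < suc n ] ∑[ j₂ < suc n ] (⟦ j₁ * 1 + (j₂ * a + (weight L c + e * partsS [] S c)) ≟ N ⟧ * 1)) ∎
    where
    open ≡-Reasoning
    Lₑ : List ℕ
    Lₑ = map (_+ e) S ++ I

  pR>S-identity : ∀ n → 3 ≤ n →
    pR>S (1 ∷ 2 ∷ []) S I n + p≤ (2 ∷ map (_+ 2) S ++ I) (n ∸ 3) ≡ p≤ (1 ∷ map (_+ 1) S ++ I) (n ∸ 1)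
  pR>S-identity n 3≤n = begin
    pR>S (1 ∷ 2 ∷ []) S I n + p≤ (2 ∷ map (_+ 2) S ++ I) (n ∸ 3)
      ≡⟨ cong₂ _+_ (pR>S-∑box n) (p≤-shift-∑box 2 2 (s≤s z≤n) (m∸n≤m n 3)) ⟩
    ∑box m n (λ c → R>S c) + ∑box m n (λ c → shifted 2 2 3 c)
      ≡⟨ ∑box-distrib-+ m n R>S (shifted 2 2 3) ⟨
    ∑box m n (λ c → R>S c + shifted 2 2 3 c)
      ≡⟨ ∑box-cong m n (λ c → pair-sums-identity n (weight L c) (partsS [] S c) 3≤n) ⟩
    ∑box m n (shifted 1 1 1)
      ≡⟨ p≤-shift-∑box 1 1 ≤-refl (m∸n≤m n 1) ⟨
    p≤ (1 ∷ map (_+ 1) S ++ I) (n ∸ 1) ∎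
    where
    open ≡-Reasoning
    R>S : List ℕ → ℕ
    R>S c = ∑[ j₁ < suc n ] ∑[ j₂ < suc n ] (⟦ j₁ * 1 + (j₂ * 2 + weight L c) ≟ n ⟧ * ⟦ partsS [] S c <? j₁ + (j₂ + 0) ⟧)
    shifted : ℕ → ℕ → ℕ → List ℕ → ℕ
    shifted e a k c = ∑[ j₁ < suc n ] ∑[ j₂ < suc n ] (⟦ j₁ * 1 + (j₂ * a + (weight L c + e * partsS [] S c)) ≟ n ∸ k ⟧ * 1)

-- Asymptotics of p≤

conv-cong : ∀ a {f g : ℕ → ℕ} → (∀ y → f y ≡ g y) → ∀ n → conv a f n ≡ conv a g n
conv-cong a f≗g n = ∑-cong (suc n) (λ j → cong (⟦ j * a ≤? n ⟧ *_) (f≗g (n ∸ j * a)))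

conv-distribˡ-* : ∀ a c (f : ℕ → ℕ) n → conv a (λ y → c * f y) n ≡ c * conv a f n
conv-distribˡ-* a c f n = trans (∑-cong (suc n) (λ j → *-CS.x∙yz≈y∙xz ⟦ j * a ≤? n ⟧ c (f (n ∸ j * a))))
                                (∑-distribˡ-* (suc n) c (λ j → ⟦ j * a ≤? n ⟧ * f (n ∸ j * a)))

conv-∣-∣ : ∀ a (f g : ℕ → ℕ) n → ∣ conv a f n - conv a g n ∣ ≤ conv a (λ y → ∣ f y - g y ∣) n
conv-∣-∣ a f g n = ≤-trans (∑-∣-∣ (suc n) (λ j → ⟦ j * a ≤? n ⟧ * f (n ∸ j * a)) (λ j → ⟦ j * a ≤? n ⟧ * g (n ∸ j * a)))
  (≤-reflexive (∑-cong (suc n) (λ j → sym (*-distribˡ-∣-∣ ⟦ j * a ≤? n ⟧ (f (n ∸ j * a)) (g (n ∸ j * a))))))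

conv-≤ : ∀ a (h : ℕ → ℕ) n M → (∀ y → y ≤ n → h y ≤ M) → conv a h n ≤ suc n * M
conv-≤ a h n M h≤M = ∑-≤-const (suc n) M (λ j → begin
  ⟦ j * a ≤? n ⟧ * h (n ∸ j * a)   ≤⟨ *-monoˡ-≤ (h (n ∸ j * a)) (⟦⟧≤1 (j * a ≤? n)) ⟩
  1 * h (n ∸ j * a)                ≡⟨ *-identityˡ _ ⟩
  h (n ∸ j * a)                    ≤⟨ h≤M (n ∸ j * a) (m∸n≤m n (j * a)) ⟩
  M                                ∎)
  where open ≤-Reasoning

conv-rec : ∀ a → 1 ≤ a → ∀ h n → conv a h n ≡ h n + ⟦ a ≤? n ⟧ * conv a h (n ∸ a)
conv-rec a 1≤a h n = begin
  h n + 0 + ∑[ j < n ] (⟦ a + j * a ≤? n ⟧ * h (n ∸ (a + j * a)))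
    ≡⟨ cong₂ _+_ (+-identityʳ (h n)) (∑-cong n split) ⟩
  h n + ∑[ j < n ] (⟦ a ≤? n ⟧ * (⟦ j * a ≤? n ∸ a ⟧ * h (n ∸ a ∸ j * a)))
    ≡⟨ cong (h n +_) (∑-distribˡ-* n ⟦ a ≤? n ⟧ _) ⟩
  h n + ⟦ a ≤? n ⟧ * ∑[ j < n ] (⟦ j * a ≤? n ∸ a ⟧ * h (n ∸ a ∸ j * a))
    ≡⟨ cong (h n +_) (⟦⟧-*-cong (a ≤? n) (λ a≤n → ∑-extend (∸-monoʳ-< 1≤a a≤n) (beyond a≤n))) ⟨
  h n + ⟦ a ≤? n ⟧ * conv a h (n ∸ a) ∎
  where
  open ≡-Reasoning
  split : ∀ j → ⟦ a + j * a ≤? n ⟧ * h (n ∸ (a + j * a)) ≡ ⟦ a ≤? n ⟧ * (⟦ j * a ≤? n ∸ a ⟧ * h (n ∸ a ∸ j * a))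
  split j = trans (cong₂ _*_ (⟦+≤⟧ a (j * a) n) (cong h (sym (∸-+-assoc n a (j * a))))) (*-assoc ⟦ a ≤? n ⟧ _ _)
  beyond : a ≤ n → ∀ j → suc (n ∸ a) ≤ j → ⟦ j * a ≤? n ∸ a ⟧ * h (n ∸ a ∸ j * a) ≡ 0
  beyond a≤n j n∸a<j = cong (_* h (n ∸ a ∸ j * a))
    (⟦⟧-no (λ ja≤n∸a → <⇒≱ n∸a<j (≤-trans (m≤m*n j a {{>-nonZero 1≤a}}) ja≤n∸a)) (j * a ≤? n ∸ a))

-- q * C n is a Riemann sum with step a for ∫₀ⁿ (d + 1) x^d dx = n^(d + 1); the binomial bounds control each step.
module _ (a : ℕ) (1≤a : 1 ≤ a) (d : ℕ) where

  private
    q : ℕ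
    q = suc d * a
    C : ℕ → ℕ
    C = conv a (_^ d)

  conv-pow-upper : ∀ n → q * C n ≤ (n + a) ^ suc d
  conv-pow-upper = <-rec (λ n → q * C n ≤ (n + a) ^ suc d) step
    where
    step : ∀ n → (∀ {m} → m < n → q * C m ≤ (m + a) ^ suc d) → q * C n ≤ (n + a) ^ suc d
    step n rec = begin
      q * C n                                   ≡⟨ cong (q *_) (conv-rec a 1≤a (_^ d) n) ⟩
      q * (n ^ d + ⟦ a ≤? n ⟧ * C (n ∸ a))      ≡⟨ *-distribˡ-+ q (n ^ d) _ ⟩
      q * n ^ d + q * (⟦ a ≤? n ⟧ * C (n ∸ a))  ≡⟨ cong (q * n ^ d +_) (*-CS.x∙yz≈y∙xz q ⟦ a ≤? n ⟧ (C (n ∸ a))) ⟩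
      q * n ^ d + ⟦ a ≤? n ⟧ * (q * C (n ∸ a))  ≤⟨ +-monoʳ-≤ (q * n ^ d) (⟦⟧-*-≤ (a ≤? n) earlier) ⟩
      q * n ^ d + n ^ suc d                     ≡⟨ +-comm (q * n ^ d) (n ^ suc d) ⟩
      n ^ suc d + q * n ^ d                     ≤⟨ binomial-lower n a d ⟩
      (n + a) ^ suc d                           ∎
      where
      open ≤-Reasoning
      earlier : a ≤ n → q * C (n ∸ a) ≤ n ^ suc d
      earlier a≤n = subst (λ m → q * C (n ∸ a) ≤ m ^ suc d) (m∸n+n≡m a≤n) (rec (∸-monoʳ-< 1≤a a≤n))

  conv-pow-lower : ∀ n → n ^ suc d ≤ q * C n + a ^ suc d
  conv-pow-lower = <-rec (λ n → n ^ suc d ≤ q * C n + a ^ suc d) step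
    where
    step : ∀ n → (∀ {m} → m < n → m ^ suc d ≤ q * C m + a ^ suc d) → n ^ suc d ≤ q * C n + a ^ suc d
    step n rec with a ≤? n
    ... | no a≰n = ≤-trans (^-monoˡ-≤ (suc d) (<⇒≤ (≰⇒> a≰n))) (m≤n+m (a ^ suc d) (q * C n))
    ... | yes a≤n = begin
      n ^ suc d                                 ≡⟨ cong (_^ suc d) (m∸n+n≡m a≤n) ⟨
      (n ∸ a + a) ^ suc d                       ≤⟨ binomial-upper (n ∸ a) a d ⟩
      (n ∸ a) ^ suc d + q * (n ∸ a + a) ^ d     ≡⟨ cong (λ m → (n ∸ a) ^ suc d + q * m ^ d) (m∸n+n≡m a≤n) ⟩
      (n ∸ a) ^ suc d + q * n ^ d               ≤⟨ +-monoˡ-≤ (q * n ^ d) (rec (∸-monoʳ-< 1≤a a≤n)) ⟩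
      q * C (n ∸ a) + a ^ suc d + q * n ^ d     ≡⟨ regroup q (C (n ∸ a)) (a ^ suc d) (n ^ d) ⟩
      q * (n ^ d + 1 * C (n ∸ a)) + a ^ suc d   ≡⟨ cong (λ x → q * (n ^ d + x * C (n ∸ a)) + a ^ suc d) (⟦⟧-yes a≤n (a ≤? n)) ⟨
      q * (n ^ d + ⟦ a ≤? n ⟧ * C (n ∸ a)) + a ^ suc d ≡⟨ cong (λ x → q * x + a ^ suc d) (conv-rec a 1≤a (_^ d) n) ⟨
      q * C n + a ^ suc d                       ∎
      where
      open ≤-Reasoning
      regroup : ∀ q c A N → q * c + A + q * N ≡ q * (N + 1 * c) + A
      regroup = solve-∀

  conv-pow-close : ∀ n → ∣ q * C n - n ^ suc d ∣ ≤ suc d * a ^ suc d * suc n ^ d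
  conv-pow-close n = m≤n+o⇒n≤m+o⇒∣m-n∣≤o upper lower
    where
    open ≤-Reasoning
    E : ℕ
    E = suc d * a ^ suc d * suc n ^ d
    n+a≤a*[1+n] : n + a ≤ a * suc n
    n+a≤a*[1+n] = begin
      n + a       ≤⟨ +-monoˡ-≤ a (m≤n*m n a {{>-nonZero 1≤a}}) ⟩
      a * n + a   ≡⟨ +-comm (a * n) a ⟩
      a + a * n   ≡⟨ *-suc a n ⟨
      a * suc n   ∎
    upper : q * C n ≤ n ^ suc d + E
    upper = begin
      q * C n                                 ≤⟨ conv-pow-upper n ⟩
      (n + a) ^ suc d                         ≤⟨ binomial-upper n a d ⟩
      n ^ suc d + q * (n + a) ^ d             ≤⟨ +-monoʳ-≤ (n ^ suc d) (*-monoʳ-≤ q (^-monoˡ-≤ d n+a≤a*[1+n])) ⟩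
      n ^ suc d + q * (a * suc n) ^ d         ≡⟨ cong (λ x → n ^ suc d + q * x) (^-distribʳ-* a (suc n) d) ⟩
      n ^ suc d + q * (a ^ d * suc n ^ d)     ≡⟨ cong (n ^ suc d +_) (reassoc (suc d) a (a ^ d) (suc n ^ d)) ⟩
      n ^ suc d + E                           ∎
      where
      reassoc : ∀ s a A N → s * a * (A * N) ≡ s * (a * A) * N
      reassoc = solve-∀
    lower : n ^ suc d ≤ q * C n + E
    lower = begin
      n ^ suc d                         ≤⟨ conv-pow-lower n ⟩
      q * C n + a ^ suc d               ≤⟨ +-monoʳ-≤ (q * C n) (m≤n*m (a ^ suc d) (suc d)) ⟩
      q * C n + suc d * a ^ suc d       ≡⟨ cong (q * C n +_) (*-identityʳ _) ⟨
      q * C n + suc d * a ^ suc d * 1   ≤⟨ +-monoʳ-≤ (q * C n) (*-monoʳ-≤ (suc d * a ^ suc d) (m^n>0 (suc n) d)) ⟩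
      q * C n + E                       ∎

conv-close : ∀ a → 1 ≤ a → ∀ e D B (f : ℕ → ℕ) → (∀ y → ∣ D * f y - y ^ suc e ∣ ≤ B * suc y ^ e) → ∀ n →
  ∣ suc (suc e) * a * (D * conv a f n) - n ^ suc (suc e) ∣ ≤ (suc (suc e) * a * B + suc (suc e) * a ^ suc (suc e)) * suc n ^ suc e
conv-close a 1≤a e D B f close n = begin
  ∣ q * (D * conv a f n) - n ^ suc d ∣
    ≤⟨ ∣-∣-triangle (q * (D * conv a f n)) (q * P) (n ^ suc d) ⟩
  ∣ q * (D * conv a f n) - q * P ∣ + ∣ q * P - n ^ suc d ∣
    ≡⟨ cong₂ (λ x y → x + ∣ q * P - y ∣) (sym (*-distribˡ-∣-∣ q _ P)) refl ⟩
  q * ∣ D * conv a f n - P ∣ + ∣ q * P - n ^ suc d ∣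
    ≡⟨ cong (λ x → q * ∣ x - P ∣ + ∣ q * P - n ^ suc d ∣) (sym (conv-distribˡ-* a D f n)) ⟩
  q * ∣ conv a (λ y → D * f y) n - P ∣ + ∣ q * P - n ^ suc d ∣
    ≤⟨ +-mono-≤ (*-monoʳ-≤ q (≤-trans (conv-∣-∣ a (λ y → D * f y) (_^ d) n) (conv-≤ a _ n (B * suc n ^ e) error≤)))
                (conv-pow-close a 1≤a d n) ⟩
  q * (suc n * (B * suc n ^ e)) + suc d * a ^ suc d * suc n ^ d
    ≡⟨ collect q (suc n) B (suc n ^ e) (suc d * a ^ suc d) ⟩
  (q * B + suc d * a ^ suc d) * suc n ^ d ∎
  where
  open ≤-Reasoning
  d : ℕ
  d = suc e
  q : ℕ
  q = suc d * a
  P : ℕ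
  P = conv a (_^ d) n
  error≤ : ∀ y → y ≤ n → ∣ D * f y - y ^ d ∣ ≤ B * suc n ^ e
  error≤ y y≤n = ≤-trans (close y) (*-monoʳ-≤ B (^-monoˡ-≤ e (s≤s y≤n)))
  collect : ∀ q s B S c → q * (s * (B * S)) + c * (s * S) ≡ (q * B + c) * (s * S)
  collect = solve-∀

-- p≤ L n ≈ n ^ length L / denom L.
denom : List ℕ → ℕ
denom L = length L ! * product L

p≤-asymptotic : ∀ a L → Positive (a ∷ L) →
  ∃[ B ] (∀ n → ∣ denom (a ∷ L) * p≤ (a ∷ L) n - n ^ length (a ∷ L) ∣ ≤ B * suc n ^ length L)
p≤-asymptotic a [] (1≤a ∷ []) = 1 * a ^ 1 , λ n → subst (λ x → ∣ x - n ^ 1 ∣ ≤ 1 * a ^ 1 * suc n ^ 0) (sym (single n)) (conv-pow-close a 1≤a 0 n)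
  where
  single : ∀ n → denom (a ∷ []) * p≤ (a ∷ []) n ≡ 1 * a * conv a (_^ 0) n
  single n = cong₂ _*_ (cong (1 *_) (*-identityʳ a)) (trans (p≤-∷ a [] (1≤a ∷ []) n) (conv-cong a p≤-[] n))
p≤-asymptotic a (b ∷ L) (1≤a ∷ bL⁺) with p≤-asymptotic b L bL⁺
... | B , close = B′ , λ n → subst (λ x → ∣ x - n ^ suc (suc e) ∣ ≤ B′ * suc n ^ suc e) (sym (unfold n))
                                   (conv-close a 1≤a e (denom (b ∷ L)) B (p≤ (b ∷ L)) close n)
  where
  e : ℕ
  e = length L
  B′ : ℕ
  B′ = suc (suc e) * a * B + suc (suc e) * a ^ suc (suc e)
  unfold : ∀ n → denom (a ∷ b ∷ L) * p≤ (a ∷ b ∷ L) n ≡ suc (suc e) * a * (denom (b ∷ L) * conv a (p≤ (b ∷ L)) n)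
  unfold n = trans (cong (denom (a ∷ b ∷ L) *_) (p≤-∷ a (b ∷ L) (1≤a ∷ bL⁺) n))
                   (regroup (suc (suc e)) (suc e !) a (product (b ∷ L)) (conv a (p≤ (b ∷ L)) n))
    where
    regroup : ∀ s F a P X → s * F * (a * P) * X ≡ s * a * (F * P * X)
    regroup = solve-∀

p≤-asymptotic′ : ∀ a L → Positive (a ∷ L) → ∀ {e} → length L ≡ e →
  ∃[ B ] (∀ n → ∣ denom (a ∷ L) * p≤ (a ∷ L) n - n ^ suc e ∣ ≤ B * suc n ^ e)
p≤-asymptotic′ a L L⁺ refl = p≤-asymptotic a L L⁺

-- Limits of ratios

∣m⊖n∣≡∣m-n∣ : ∀ m n → ℤ.∣ m ⊖ n ∣ ≡ ∣ m - n ∣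
∣m⊖n∣≡∣m-n∣ zero    zero    = refl
∣m⊖n∣≡∣m-n∣ zero    (suc n) = refl
∣m⊖n∣≡∣m-n∣ (suc m) zero    = refl
∣m⊖n∣≡∣m-n∣ (suc m) (suc n) = trans (cong ℤ.∣_∣ (ℤ.[1+m]⊖[1+n]≡m⊖n m n)) (∣m⊖n∣≡∣m-n∣ m n)

ratio-close : ∀ a b p c (ε : ℚ) → 0ℚ ℚ.< ε →
  ∣ a * c - p * b ∣ * ℚ.↧ₙ ε < b * c → ℚ.∣ ratio a b ℚ.- ratio p c ∣ ℚ.< ε
ratio-close a zero    p c       ε _ ()
ratio-close a (suc b) p zero    ε _ close = contradiction (subst (∣ a * 0 - p * suc b ∣ * ℚ.↧ₙ ε <_) (*-zeroʳ (suc b)) close) n≮0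
ratio-close a (suc b) p (suc c) (mkℚ (ℤ.+ zero)   _ _) (ℚ.*<* (ℤ.+<+ ()))
ratio-close a (suc b) p (suc c) (mkℚ -[1+ _ ]   _ _) (ℚ.*<* ())
ratio-close a (suc b) p (suc c) (mkℚ (ℤ.+ suc u) v _) _ close = ℚ.toℚᵘ-cancel-< (ℚᵘ.<-respˡ-≃ (ℚᵘ.≃-sym as-ℚᵘ) cross)
  where
  x : ℚ
  x = ratio a (suc b)
  y : ℚ
  y = ratio p (suc c)
  as-ℚᵘ : toℚᵘ ℚ.∣ x ℚ.- y ∣ ℚᵘ.≃ ℚᵘ.∣ mkℚᵘ (ℤ.+ a) b ℚᵘ.- mkℚᵘ (ℤ.+ p) c ∣
  as-ℚᵘ = ℚᵘ.≃-trans (ℚ.toℚᵘ-homo-∣-∣ (x ℚ.- y)) (ℚᵘ.∣-∣-cong (ℚᵘ.≃-trans (ℚ.toℚᵘ-homo-+ x (ℚ.- y))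
            (ℚᵘ.+-cong (ℚ.toℚᵘ-fromℚᵘ (mkℚᵘ (ℤ.+ a) b))
                       (ℚᵘ.≃-trans (ℚ.toℚᵘ-homo‿- y) (ℚᵘ.-‿cong (ℚ.toℚᵘ-fromℚᵘ (mkℚᵘ (ℤ.+ p) c)))))))
  numerator : ℤ.∣ (ℤ.+ a) ℤ.* (ℤ.+ suc c) ℤ.+ (ℤ.- (ℤ.+ p)) ℤ.* (ℤ.+ suc b) ∣ ≡ ∣ a * suc c - p * suc b ∣
  numerator = begin
    ℤ.∣ (ℤ.+ a) ℤ.* (ℤ.+ suc c) ℤ.+ (ℤ.- (ℤ.+ p)) ℤ.* (ℤ.+ suc b) ∣
      ≡⟨ cong ℤ.∣_∣ (cong₂ ℤ._+_ (sym (ℤ.pos-* a (suc c))) (sym (ℤ.neg-distribˡ-* (ℤ.+ p) (ℤ.+ suc b)))) ⟩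
    ℤ.∣ ℤ.+ (a * suc c) ℤ.+ ℤ.- ((ℤ.+ p) ℤ.* (ℤ.+ suc b)) ∣
      ≡⟨ cong (λ z → ℤ.∣ ℤ.+ (a * suc c) ℤ.+ ℤ.- z ∣) (sym (ℤ.pos-* p (suc b))) ⟩
    ℤ.∣ ℤ.+ (a * suc c) ℤ.+ ℤ.- (ℤ.+ (p * suc b)) ∣
      ≡⟨ cong ℤ.∣_∣ (ℤ.m-n≡m⊖n (a * suc c) (p * suc b)) ⟩
    ℤ.∣ (a * suc c) ⊖ (p * suc b) ∣
      ≡⟨ ∣m⊖n∣≡∣m-n∣ (a * suc c) (p * suc b) ⟩
    ∣ a * suc c - p * suc b ∣ ∎
    where open ≡-Reasoning
  cross : ℚᵘ.∣ mkℚᵘ (ℤ.+ a) b ℚᵘ.- mkℚᵘ (ℤ.+ p) c ∣ ℚᵘ.< mkℚᵘ (ℤ.+ suc u) v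
  cross = *<* (subst₂ ℤ._<_ (ℤ.pos-* ℤ.∣ (ℤ.+ a) ℤ.* (ℤ.+ suc c) ℤ.+ (ℤ.- (ℤ.+ p)) ℤ.* (ℤ.+ suc b) ∣ (suc v)) (ℤ.pos-* (suc u) (suc b * suc c))
            (ℤ.+<+ (subst (λ z → z * suc v < suc u * (suc b * suc c)) (sym numerator)
              (<-≤-trans close (m≤n*m (suc b * suc c) (suc u))))))

pow-dominates : ∀ A e n → A * 2 ^ e < n → A * suc n ^ e < n ^ suc e
pow-dominates A e n A2ᵉ<n = begin-strict
  A * suc n ^ e        ≤⟨ *-monoʳ-≤ A (^-monoˡ-≤ e 1+n≤2n) ⟩
  A * (2 * n) ^ e      ≡⟨ cong (A *_) (^-distribʳ-* 2 n e) ⟩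
  A * (2 ^ e * n ^ e)  ≡⟨ *-assoc A (2 ^ e) (n ^ e) ⟨
  A * 2 ^ e * n ^ e    <⟨ *-monoˡ-< (n ^ e) {{m^n≢0 n e {{>-nonZero 0<n}}}} A2ᵉ<n ⟩
  n * n ^ e            ∎
  where
  open ≤-Reasoning
  0<n : 0 < n
  0<n = ≤-<-trans z≤n A2ᵉ<n
  1+n≤2n : suc n ≤ 2 * n
  1+n≤2n = subst₂ _≤_ (+-comm n 1) (cong (n +_) (sym (+-identityʳ n))) (+-monoʳ-≤ n 0<n)

ratio-converges : ∀ (g f : ℕ → ℕ) p c e D B K n₀ → 1 ≤ c →
  (∀ n → ∣ D * f n - n ^ suc e ∣ ≤ B * suc n ^ e) →
  (∀ n → n₀ ≤ n → D * ∣ g n * c - p * f n ∣ ≤ K * suc n ^ e) →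
  ConvergesTo (λ n → ratio (g n) (f n)) (ratio p c)
ratio-converges g f p c e D B K n₀ 1≤c f-close gap ε 0<ε = n₀ + suc (A * 2 ^ e) , tail
  where
  den : ℕ
  den = ℚ.↧ₙ ε
  A : ℕ
  A = K * den + c * B
  tail : ∀ n → n₀ + suc (A * 2 ^ e) ≤ n → ℚ.∣ ratio (g n) (f n) ℚ.- ratio p c ∣ ℚ.< ε
  tail n N≤n = ratio-close (g n) (f n) p c ε 0<ε (*-cancelˡ-< D _ _ (begin-strict
    D * (∣ g n * c - p * f n ∣ * den)   ≡⟨ *-assoc D _ den ⟨
    D * ∣ g n * c - p * f n ∣ * den     ≤⟨ *-monoˡ-≤ den (gap n (m+n≤o⇒m≤o n₀ N≤n)) ⟩
    K * T * den                         <⟨ +-cancelʳ-< (c * B * T) (K * T * den) (c * (D * f n)) main ⟩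
    c * (D * f n)                       ≡⟨ *-CS.x∙yz≈y∙xz c D (f n) ⟩
    D * (c * f n)                       ≡⟨ cong (D *_) (*-comm c (f n)) ⟩
    D * (f n * c)                       ∎))
    where
    open ≤-Reasoning
    T : ℕ
    T = suc n ^ e
    main : K * T * den + c * B * T < c * (D * f n) + c * B * T
    main = begin-strict
      K * T * den + c * B * T    ≡⟨ regroup c B T K den ⟩
      A * T                      <⟨ pow-dominates A e n (m+n≤o⇒n≤o n₀ N≤n) ⟩
      n ^ suc e                  ≤⟨ m≤n*m (n ^ suc e) c {{>-nonZero 1≤c}} ⟩
      c * n ^ suc e              ≤⟨ *-monoʳ-≤ c (≤-trans (m≤n+∣n-m∣ (n ^ suc e) (D * f n)) (+-monoʳ-≤ (D * f n) (f-close n))) ⟩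
      c * (D * f n + B * T)      ≡⟨ distribute c (D * f n) B T ⟩
      c * (D * f n) + c * B * T  ∎
      where
      regroup : ∀ c B T K den → K * T * den + c * B * T ≡ (K * den + c * B) * T
      regroup = solve-∀
      distribute : ∀ c X B T → c * (X + B * T) ≡ c * X + c * B * T
      distribute = solve-∀

cancellation-estimate : ∀ {G N A₁ A₂ D₀ D₁ D₂ x u v w X E₀ E₁ E₂} →
  G + A₂ ≡ A₁ → x * D₀ ≡ u * D₁ → x * D₀ ≡ v * D₂ → w + v ≡ u →
  ∣ D₀ * N - X ∣ ≤ E₀ → ∣ D₁ * A₁ - X ∣ ≤ E₁ → ∣ D₂ * A₂ - X ∣ ≤ E₂ →
  D₀ * ∣ G * x - w * N ∣ ≤ u * E₁ + v * E₂ + w * E₀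
cancellation-estimate {G} {N} {A₁} {A₂} {D₀} {D₁} {D₂} {x} {u} {v} {w} {X} {E₀} {E₁} {E₂}
                      G+A₂≡A₁ xD₀≡uD₁ xD₀≡vD₂ w+v≡u N≈ A₁≈ A₂≈ = begin
  D₀ * ∣ G * x - w * N ∣                                   ≡⟨ *-distribˡ-∣-∣ D₀ (G * x) (w * N) ⟩
  ∣ D₀ * (G * x) - D₀ * (w * N) ∣                          ≡⟨ cong₂ ∣_-_∣ (regroup D₀ G x) (*-CS.x∙yz≈y∙xz D₀ w N) ⟩
  ∣ x * D₀ * G - w * (D₀ * N) ∣                            ≤⟨ ∣-∣-triangle (x * D₀ * G) (w * X) (w * (D₀ * N)) ⟩
  ∣ x * D₀ * G - w * X ∣ + ∣ w * X - w * (D₀ * N) ∣        ≤⟨ +-mono-≤ main (≤-reflexive (sym (*-distribˡ-∣-∣ w X (D₀ * N)))) ⟩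
  u * E₁ + v * E₂ + w * ∣ X - D₀ * N ∣
    ≤⟨ +-monoʳ-≤ (u * E₁ + v * E₂) (*-monoʳ-≤ w (subst (_≤ E₀) (∣-∣-comm (D₀ * N) X) N≈)) ⟩
  u * E₁ + v * E₂ + w * E₀                                 ∎
  where
  open ≤-Reasoning
  regroup : ∀ D G x → D * (G * x) ≡ x * D * G
  regroup = solve-∀
  -- x D₀ G + v D₂ A₂ = u D₁ A₁, so x D₀ G ≈ (u − v) X up to the errors of u D₁ A₁ ≈ u X and v D₂ A₂ ≈ v X.
  main : ∣ x * D₀ * G - w * X ∣ ≤ u * E₁ + v * E₂
  main = begin
    ∣ x * D₀ * G - w * X ∣                                          ≤⟨ ∣m-o∣≤∣m+n-o+p∣+∣n-p∣ (x * D₀ * G) (v * D₂ * A₂) (w * X) (v * X) ⟩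
    ∣ x * D₀ * G + v * D₂ * A₂ - w * X + v * X ∣ + ∣ v * D₂ * A₂ - v * X ∣
      ≡⟨ cong₂ (λ a b → ∣ a - b ∣ + ∣ v * D₂ * A₂ - v * X ∣) total (trans (sym (*-distribʳ-+ X w v)) (cong (_* X) w+v≡u)) ⟩
    ∣ u * D₁ * A₁ - u * X ∣ + ∣ v * D₂ * A₂ - v * X ∣
      ≡⟨ cong₂ (λ a b → ∣ a - u * X ∣ + ∣ b - v * X ∣) (*-assoc u D₁ A₁) (*-assoc v D₂ A₂) ⟩
    ∣ u * (D₁ * A₁) - u * X ∣ + ∣ v * (D₂ * A₂) - v * X ∣
      ≡⟨ cong₂ _+_ (*-distribˡ-∣-∣ u (D₁ * A₁) X) (*-distribˡ-∣-∣ v (D₂ * A₂) X) ⟨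
    u * ∣ D₁ * A₁ - X ∣ + v * ∣ D₂ * A₂ - X ∣                       ≤⟨ +-mono-≤ (*-monoʳ-≤ u A₁≈) (*-monoʳ-≤ v A₂≈) ⟩
    u * E₁ + v * E₂                                                  ∎
    where
    total : x * D₀ * G + v * D₂ * A₂ ≡ u * D₁ * A₁
    total = begin-equality
      x * D₀ * G + v * D₂ * A₂       ≡⟨ cong (λ y → x * D₀ * G + y * A₂) xD₀≡vD₂ ⟨
      x * D₀ * G + x * D₀ * A₂       ≡⟨ *-distribˡ-+ (x * D₀) G A₂ ⟨
      x * D₀ * (G + A₂)              ≡⟨ cong₂ _*_ xD₀≡uD₁ G+A₂≡A₁ ⟩
      u * D₁ * A₁                    ∎

∣-∣-pow-shift : ∀ y n a e {B} → a ≤ n → ∣ y - (n ∸ a) ^ suc e ∣ ≤ B → ∣ y - n ^ suc e ∣ ≤ B + a * suc e * suc n ^ e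
∣-∣-pow-shift y n a e {B} a≤n close = begin
  ∣ y - n ^ suc e ∣                                        ≤⟨ ∣-∣-triangle y ((n ∸ a) ^ suc e) (n ^ suc e) ⟩
  ∣ y - (n ∸ a) ^ suc e ∣ + ∣ (n ∸ a) ^ suc e - n ^ suc e ∣ ≤⟨ +-mono-≤ close (m≤n+o⇒n≤m+o⇒∣m-n∣≤o lower upper) ⟩
  B + a * suc e * suc n ^ e                                ∎
  where
  open ≤-Reasoning
  lower : (n ∸ a) ^ suc e ≤ n ^ suc e + a * suc e * suc n ^ e
  lower = ≤-trans (^-monoˡ-≤ (suc e) (m∸n≤m n a)) (m≤m+n (n ^ suc e) _)
  upper : n ^ suc e ≤ (n ∸ a) ^ suc e + a * suc e * suc n ^ e
  upper = begin
    n ^ suc e                                   ≡⟨ cong (_^ suc e) (m∸n+n≡m a≤n) ⟨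
    (n ∸ a + a) ^ suc e                         ≤⟨ binomial-upper (n ∸ a) a e ⟩
    (n ∸ a) ^ suc e + suc e * a * (n ∸ a + a) ^ e
      ≡⟨ cong₂ (λ c m → (n ∸ a) ^ suc e + c * m ^ e) (*-comm (suc e) a) (m∸n+n≡m a≤n) ⟩
    (n ∸ a) ^ suc e + a * suc e * n ^ e         ≤⟨ +-monoʳ-≤ ((n ∸ a) ^ suc e) (*-monoʳ-≤ (a * suc e) (^-monoˡ-≤ e (n≤1+n n))) ⟩
    (n ∸ a) ^ suc e + a * suc e * suc n ^ e     ∎

-- The limit w / x is D₀/D₁ − D₀/D₂, for the denominators of p_{RSI} and of the two counts in pR>S-identity.
pR>S-ratio-converges : ∀ S I → Positive S → Positive I → ∀ x u v w → 1 ≤ x → w + v ≡ u →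
  x * denom (2 ∷ S ++ I) ≡ u * denom (1 ∷ map (_+ 1) S ++ I) →
  x * denom (2 ∷ S ++ I) ≡ v * denom (2 ∷ map (_+ 2) S ++ I) →
  ConvergesTo (λ n → ratio (pR>S (1 ∷ 2 ∷ []) S I n) (pRSI (1 ∷ 2 ∷ []) S I n)) (ratio w x)
pR>S-ratio-converges S I S⁺ I⁺ x u v w 1≤x w+v≡u xD₀≡uD₁ xD₀≡vD₂
  with p≤-asymptotic′ 2 (S ++ I) (s≤s z≤n ∷ AllP.++⁺ S⁺ I⁺) refl
     | p≤-asymptotic′ 1 (map (_+ 1) S ++ I) (≤-refl ∷ AllP.++⁺ (Positive-shift 1 S⁺) I⁺) (length-shift 1 S I)
     | p≤-asymptotic′ 2 (map (_+ 2) S ++ I) (s≤s z≤n ∷ AllP.++⁺ (Positive-shift 2 S⁺) I⁺) (length-shift 2 S I)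
... | B₀ , N≈ | B₁ , A₁≈ | B₂ , A₂≈ =
  ratio-converges (pR>S (1 ∷ 2 ∷ []) S I) (p≤ (2 ∷ S ++ I)) w x e (denom (2 ∷ S ++ I)) B₀ K 3 1≤x N≈ gap
  where
  L₁ : List ℕ
  L₁ = 1 ∷ map (_+ 1) S ++ I
  L₂ : List ℕ
  L₂ = 2 ∷ map (_+ 2) S ++ I
  e : ℕ
  e = length (S ++ I)
  d : ℕ
  d = suc e
  K : ℕ
  K = u * (B₁ + 1 * d) + v * (B₂ + 3 * d) + w * B₀
  gap : ∀ n → 3 ≤ n → denom (2 ∷ S ++ I) * ∣ pR>S (1 ∷ 2 ∷ []) S I n * x - w * p≤ (2 ∷ S ++ I) n ∣ ≤ K * suc n ^ e
  gap n 3≤n = ≤-trans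
    (cancellation-estimate {x = x} {u} {v} {w} (pR>S-identity S I S⁺ I⁺ n 3≤n) xD₀≡uD₁ xD₀≡vD₂ w+v≡u (N≈ n) A₁≈nᵈ A₂≈nᵈ)
    (≤-reflexive (collect u v w B₀ B₁ B₂ d T))
    where
    T : ℕ
    T = suc n ^ e
    A₁≈nᵈ : ∣ denom L₁ * p≤ L₁ (n ∸ 1) - n ^ d ∣ ≤ B₁ * T + 1 * d * T
    A₁≈nᵈ = ∣-∣-pow-shift (denom L₁ * p≤ L₁ (n ∸ 1)) n 1 e (≤-trans (s≤s z≤n) 3≤n) (≤-trans (A₁≈ (n ∸ 1)) (*-monoʳ-≤ B₁ (^-monoˡ-≤ e (s≤s (m∸n≤m n 1)))))
    A₂≈nᵈ : ∣ denom L₂ * p≤ L₂ (n ∸ 3) - n ^ d ∣ ≤ B₂ * T + 3 * d * T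
    A₂≈nᵈ = ∣-∣-pow-shift (denom L₂ * p≤ L₂ (n ∸ 3)) n 3 e 3≤n (≤-trans (A₂≈ (n ∸ 3)) (*-monoʳ-≤ B₂ (^-monoˡ-≤ e (s≤s (m∸n≤m n 3)))))
    collect : ∀ u v w B₀ B₁ B₂ d T →
      u * (B₁ * T + 1 * d * T) + v * (B₂ * T + 3 * d * T) + w * (B₀ * T) ≡ (u * (B₁ + 1 * d) + v * (B₂ + 3 * d) + w * B₀) * T
    collect = solve-∀

-- The case S = {3, …, k}

rising : ℕ → ℕ → ℕ
rising b s = product (map (_+ b) (upTo s))

product-map-upTo-suc : ∀ (f : ℕ → ℕ) s → product (map f (upTo (suc s))) ≡ product (map f (upTo s)) * f s
product-map-upTo-suc f s = begin
  product (map f (upTo (suc s)))           ≡⟨ cong (product ∘ map f) (upTo-∷ʳ s) ⟨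
  product (map f (upTo s ++ [ s ]))        ≡⟨ cong product (map-++ f (upTo s) [ s ]) ⟩
  product (map f (upTo s) ++ [ f s ])      ≡⟨ product-++ (map f (upTo s)) [ f s ] ⟩
  product (map f (upTo s)) * (f s * 1)     ≡⟨ cong (product (map f (upTo s)) *_) (*-identityʳ (f s)) ⟩
  product (map f (upTo s)) * f s           ∎
  where open ≡-Reasoning

rising-telescope : ∀ b s → b * rising (suc b) s ≡ rising b s * (s + b)
rising-telescope b zero    = trans (*-identityʳ b) (sym (+-identityʳ b))
rising-telescope b (suc s) = begin
  b * rising (suc b) (suc s)                ≡⟨ cong (b *_) (product-map-upTo-suc (_+ suc b) s) ⟩
  b * (rising (suc b) s * (s + suc b))      ≡⟨ *-assoc b _ _ ⟨
  b * rising (suc b) s * (s + suc b)        ≡⟨ cong₂ _*_ (rising-telescope b s) (+-suc s b) ⟩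
  rising b s * (s + b) * (suc s + b)        ≡⟨ cong (_* (suc s + b)) (product-map-upTo-suc (_+ b) s) ⟨
  rising b (suc s) * (suc s + b)            ∎
  where open ≡-Reasoning

product-map-rangeS : ∀ k j → product (map (_+ j) (rangeS k)) ≡ rising (3 + j) (k ∸ 2)
product-map-rangeS k j = cong product (trans (sym (map-∘ (upTo (k ∸ 2)))) (map-cong (λ i → +-assoc i 3 j) (upTo (k ∸ 2))))

Positive-rangeS : ∀ k → Positive (rangeS k)
Positive-rangeS k = AllP.map⁺ (universal (λ i → ≤-trans (s≤s z≤n) (m≤n+m 3 i)) (upTo (k ∸ 2)))

denom-shift-rangeS : ∀ k a j I →
  denom (a ∷ map (_+ j) (rangeS k) ++ I) ≡ suc (length (rangeS k ++ I)) ! * (a * (rising (3 + j) (k ∸ 2) * product I))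
denom-shift-rangeS k a j I = cong₂ (λ l P → suc l ! * (a * P)) (length-shift j (rangeS k) I)
  (trans (product-++ (map (_+ j) (rangeS k)) I) (cong (_* product I) (product-map-rangeS k j)))

rangeS-denominators : ∀ k → 2 ≤ k → ∀ I →
  (k + 1) * (k + 2) * denom (2 ∷ rangeS k ++ I) ≡ 6 * (k + 2) * denom (1 ∷ map (_+ 1) (rangeS k) ++ I) ×
  (k + 1) * (k + 2) * denom (2 ∷ rangeS k ++ I) ≡ 12 * denom (2 ∷ map (_+ 2) (rangeS k) ++ I)
rangeS-denominators k 2≤k I =
  trans (cong (x *_) D₀) (trans common (trans (e₂ k F P R₁) (cong (6 * (k + 2) *_) (sym (denom-shift-rangeS k 1 1 I))))) ,
  trans (cong (x *_) D₀) (trans common (trans (e₃ k F P R₁) (trans (cong (6 * F * P *_) (sym tel₄))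
    (trans (e₄ F P R₂) (cong (12 *_) (sym (denom-shift-rangeS k 2 2 I)))))))
  where
  s : ℕ
  s = k ∸ 2
  x : ℕ
  x = (k + 1) * (k + 2)
  F : ℕ
  F = suc (length (rangeS k ++ I)) !
  P : ℕ
  P = product I
  R₀ : ℕ
  R₀ = rising 3 s
  R₁ : ℕ
  R₁ = rising 4 s
  R₂ : ℕ
  R₂ = rising 5 s
  D₀ : denom (2 ∷ rangeS k ++ I) ≡ F * (2 * (R₀ * P))
  D₀ = cong (λ Q → F * (2 * Q)) (product-++ (rangeS k) I)
  s+2≡k : s + 2 ≡ k
  s+2≡k = m∸n+n≡m 2≤k
  tel₃ : 3 * R₁ ≡ R₀ * (k + 1)
  tel₃ = trans (rising-telescope 3 s) (cong (R₀ *_) (trans (sym (+-assoc s 2 1)) (cong (_+ 1) s+2≡k)))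
  tel₄ : 4 * R₂ ≡ R₁ * (k + 2)
  tel₄ = trans (rising-telescope 4 s) (cong (R₁ *_) (trans (sym (+-assoc s 2 2)) (cong (_+ 2) s+2≡k)))
  e₁ : ∀ k F P R₀ → (k + 1) * (k + 2) * (F * (2 * (R₀ * P))) ≡ 2 * (k + 2) * F * P * (R₀ * (k + 1))
  e₁ = solve-∀
  e₂ : ∀ k F P R₁ → 2 * (k + 2) * F * P * (3 * R₁) ≡ 6 * (k + 2) * (F * (1 * (R₁ * P)))
  e₂ = solve-∀
  e₃ : ∀ k F P R₁ → 2 * (k + 2) * F * P * (3 * R₁) ≡ 6 * F * P * (R₁ * (k + 2))
  e₃ = solve-∀
  e₄ : ∀ F P R₂ → 6 * F * P * (4 * R₂) ≡ 12 * (F * (2 * (R₂ * P)))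
  e₄ = solve-∀
  common : x * (F * (2 * (R₀ * P))) ≡ 2 * (k + 2) * F * P * (3 * R₁)
  common = trans (e₁ k F P R₀) (cong (2 * (k + 2) * F * P *_) (sym tel₃))

corollary3 : (k : ℕ) → 3 ≤ k → (I : List ℕ) → Unique I → All (λ i → k < i) I →
    ConvergesTo (λ n → ratio (pR>S (1 ∷ 2 ∷ []) (rangeS k) I n) (pRSI (1 ∷ 2 ∷ []) (rangeS k) I n))
                (ratio (6 * k) ((k + 1) * (k + 2)))
corollary3 k 3≤k I _ k<I =
  let (xD₀≡uD₁ , xD₀≡vD₂) = rangeS-denominators k (≤-trans (n≤1+n 2) 3≤k) I
  in pR>S-ratio-converges (rangeS k) I (Positive-rangeS k) (All.map (≤-trans (s≤s z≤n)) k<I)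
       ((k + 1) * (k + 2)) (6 * (k + 2)) 12 (6 * k) 1≤[k+1][k+2] (6k+12≡6[k+2] k) xD₀≡uD₁ xD₀≡vD₂
  where
  1≤[k+1][k+2] : 1 ≤ (k + 1) * (k + 2)
  1≤[k+1][k+2] = *-mono-≤ (m≤n+m 1 k) (≤-trans (s≤s z≤n) (m≤n+m 2 k))
  6k+12≡6[k+2] : ∀ k → 6 * k + 12 ≡ 6 * (k + 2)
  6k+12≡6[k+2] = solve-∀
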